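{- Let $p>2$ be a prime, let $t$ be a positive divisor of $p-1$, let $k$ be an integer with $1<k<p/2$, and let $a\in\mathbb{F}_p^*$. Put $r_0(k)=\left\lfloor \frac{\log(p/2)}{\log k}\right\rfloor$ and $s=s_0(k,t)=\max\left\{s'\in\mathbb{Z}_{\ge 0}~:~\binom{r_0(k)+s'}{s'}\le t\right\}$. Then $$\#\{|x|~:~x\in U(k,t,a)\}\le\Psi(k,p_{s+1}).$$
   Context: $\mathbb{F}_p$ is the field of residues modulo $p$ and $\mathbb{F}_p^*=\mathbb{F}_p\setminus\{0\}$. For $x\in\mathbb{F}_p$ its integer height is $|x|=\min\{|a|~:~a\in\mathbb{Z},\ a\equiv x \pmod p\}$. For $t\mid p-1$, $G$ denotes the unique subgroup of $\mathbb{F}_p^*$ of order $t$, and $aG=\{ag~:~g\in G\}$. Define $U(k,t,a)=\{x\in aG~:~|x|\le k\}$. $\Psi(x,y)$ is the number of positive integers $n\le x$ all of whose prime factors are at most $y$. $p_j$ denotes the $j$-th prime ($p_1=2$). -}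

module Defs where

open import Data.Nat using (ℕ; zero; suc; _+_; _*_; _∸_; _^_; _≤_; _<_; _⊓_; NonZero)
open import Data.Nat.Properties using (_≟_; _≤?_)
open import Data.Nat.DivMod using (_%_)
open import Data.Nat.Divisibility using (_∣_; _∣?_)
open import Data.Nat.Primality using (Prime; prime?)
open import Data.Nat.Combinatorics using (_C_)
open import Data.Fin using (Fin; toℕ)
open import Data.Fin.Properties using (any?; all?)
open import Data.List using (List; length; filter; upTo; map)
open import Data.Product using (Σ; ∃; _×_; _,_)
open import Relation.Nullary using (Dec)
open import Relation.Nullary.Decidable using (_×-dec_; _→-dec_)

-- Elements of 𝔽_p are represented by their canonical residues 0 ≤ x < p.

-- Integer height |x| = min{|b| : b ≡ x (mod p)} of the residue 0 ≤ x < p.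
height : ℕ → ℕ → ℕ
height p x = x ⊓ (p ∸ x)

-- g ∈ G, the unique subgroup of 𝔽_p^* of order t (t ∣ p-1): G = {g : g^t = 1}.
InG : (p t : ℕ) → .{{NonZero p}} → ℕ → Set
InG p t g = (g ^ t) % p ≡ 1
  where open import Relation.Binary.PropositionalEquality using (_≡_)

InAG : (p t a : ℕ) → .{{NonZero p}} → ℕ → Set
InAG p t a x = ∃ λ (g : Fin p) → InG p t (toℕ g) × x % p ≡ (a * toℕ g) % p
  where open import Relation.Binary.PropositionalEquality using (_≡_)

-- h ∈ {|x| : x ∈ U(k,t,a)},  U(k,t,a) = {x ∈ aG : |x| ≤ k}.
IsHeightInU : (p k t a : ℕ) → .{{NonZero p}} → ℕ → Set
IsHeightInU p k t a h =
  ∃ λ (x : Fin p) → (InAG p t a (toℕ x) × height p (toℕ x) ≤ k) × height p (toℕ x) ≡ h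
  where open import Relation.Binary.PropositionalEquality using (_≡_)

isHeightInU? : (p k t a : ℕ) → .{{_ : NonZero p}} → (h : ℕ) → Dec (IsHeightInU p k t a h)
isHeightInU? p k t a h =
  any? λ x → ((any? λ g → ((toℕ g ^ t) % p ≟ 1) ×-dec ((toℕ x % p) ≟ ((a * toℕ g) % p)))
               ×-dec (height p (toℕ x) ≤? k))
             ×-dec (height p (toℕ x) ≟ h)

-- #{|x| : x ∈ U(k,t,a)}: every such height lies in {0,…,k}, so count those h ≤ k.
heightCount : (p k t a : ℕ) → .{{NonZero p}} → ℕ
heightCount p k t a = length (filter (isHeightInU? p k t a) (upTo (suc k)))

-- n is y-smooth: every prime factor q of n satisfies q ≤ y
-- (prime factors of n ≥ 1 are ≤ n, so q ranges over 0..n).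
Smooth : ℕ → ℕ → Set
Smooth y n = (q : Fin (suc n)) → Prime (toℕ q) → toℕ q ∣ n → toℕ q ≤ y

smooth? : (y n : ℕ) → Dec (Smooth y n)
smooth? y n = all? λ q → prime? (toℕ q) →-dec ((toℕ q ∣? n) →-dec (toℕ q ≤? y))

Ψ : ℕ → ℕ → ℕ
Ψ x y = length (filter (smooth? y) (map suc (upTo x)))

primesBelow : ℕ → ℕ
primesBelow q = length (filter prime? (upTo q))

-- q = p_j, the j-th prime (p_1 = 2): q is prime and exactly j-1 primes are below q.
IsNthPrime : ℕ → ℕ → Set
IsNthPrime j q = Prime q × suc (primesBelow q) ≡ j
  where open import Relation.Binary.PropositionalEquality using (_≡_)

-- r = r₀(k) = ⌊log(p/2)/log k⌋, i.e. the largest r with k^r ≤ p/2.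
IsR0 : (p k r : ℕ) → Set
IsR0 p k r = (2 * k ^ r ≤ p) × ((r' : ℕ) → 2 * k ^ r' ≤ p → r' ≤ r)

IsS0 : (r t s : ℕ) → Set
IsS0 r t s = ((r + s) C s ≤ t) × ((s' : ℕ) → (r + s') C s' ≤ t → s' ≤ s)

-- View each height h (1 ≤ h ≤ k) through its vector of prime multiplicities. If s + 2 of these
-- vectors are linearly independent, pick x_j ∈ aG with |x_j| = h_j: the (r₀ + s + 1) C (s + 1) > t
-- monomials of degree r₀ in the x_j all solve Y^t = a^(r₀ t), and they are pairwise incongruent
-- mod p, since their squares are those of the same monomials N in the h_j, which are distinct (by
-- independence) integers with N ≤ k^r₀ ≤ p/2; but Y^t - a^(r₀ t) has at most t roots. Otherwise
-- Gaussian elimination yields at most s + 1 primes whose multiplicities determine every height, and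
-- replacing them injectively by primes ≤ p_(s+1), never increasing them, sends the heights
-- injectively to p_(s+1)-smooth numbers ≤ k.

module Submission where

open import Defs
open import Data.Nat using (ℕ; suc; _≤_; _<_; NonZero)
open import Data.Nat.Primality using (Prime)

module Congruence where

  open import Data.Nat as ℕ using (ℕ; zero; suc; s≤s; NonZero)
  open import Data.Nat.Primality using (Prime; euclidsLemma; prime⇒nonTrivial)
  import Data.Nat.Divisibility as ℕ
  open import Data.Nat.DivMod using (_%_; _/_; m≡m%n+[m/n]*n)
  open import Data.Integer as ℤ using (ℤ; +_; _+_; _*_; _-_; -_)
  import Data.Integer.Properties as ℤ
  open import Data.Integer.Divisibility.Signed
    using (_∣_; divides; ∣⇒∣ᵤ; ∣ᵤ⇒∣; ∣m⇒∣-m; ∣m∣n⇒∣m+n; ∣n⇒∣m*n; ∣m⇒∣m*n)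
  open import Data.Integer.Tactic.RingSolver using (solve-∀)
  open import Data.Sum using (_⊎_; inj₁; inj₂)
  open import Relation.Nullary using (¬_)
  open import Relation.Binary using (Setoid)
  open import Relation.Binary.PropositionalEquality

  infix 4 _≈_mod_
  record _≈_mod_ (x y : ℤ) (p : ℕ) : Set where
    constructor mk≈
    field p∣x-y : + p ∣ x - y
  open _≈_mod_ public

  module _ {p : ℕ} where

    ≈-reflexive : ∀ {x y} → x ≡ y → x ≈ y mod p
    ≈-reflexive {x} refl = mk≈ (divides (+ 0) (trans (ℤ.+-inverseʳ x) (sym (ℤ.*-zeroˡ (+ p)))))

    ≈-refl : ∀ {x} → x ≈ x mod p
    ≈-refl = ≈-reflexive refl

    ≈-sym : ∀ {x y} → x ≈ y mod p → y ≈ x mod p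
    ≈-sym {x} {y} (mk≈ d) = mk≈ (subst (+ p ∣_) (neg-diff x y) (∣m⇒∣-m d))
      where neg-diff : ∀ x y → - (x - y) ≡ y - x
            neg-diff = solve-∀

    ≈-trans : ∀ {x y z} → x ≈ y mod p → y ≈ z mod p → x ≈ z mod p
    ≈-trans {x} {y} {z} (mk≈ d) (mk≈ e) = mk≈ (subst (+ p ∣_) (telescope x y z) (∣m∣n⇒∣m+n d e))
      where telescope : ∀ x y z → (x - y) + (y - z) ≡ x - z
            telescope = solve-∀

    ≈-setoid : Setoid _ _
    ≈-setoid = record
      { Carrier = ℤ ; _≈_ = λ x y → x ≈ y mod p
      ; isEquivalence = record { refl = ≈-refl ; sym = ≈-sym ; trans = ≈-trans } }

    *-cong-mod : ∀ {x x′ y y′} → x ≈ x′ mod p → y ≈ y′ mod p → x * y ≈ x′ * y′ mod p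
    *-cong-mod {x} {x′} {y} {y′} (mk≈ d) (mk≈ e) =
      mk≈ (subst (+ p ∣_) (split x x′ y y′) (∣m∣n⇒∣m+n (∣n⇒∣m*n x e) (∣m⇒∣m*n y′ d)))
      where split : ∀ x x′ y y′ → x * (y - y′) + (x - x′) * y′ ≡ x * y - x′ * y′
            split = solve-∀

    ^-cong-mod : ∀ {x y} n → x ≈ y mod p → x ℤ.^ n ≈ y ℤ.^ n mod p
    ^-cong-mod zero    x≈y = ≈-refl
    ^-cong-mod (suc n) x≈y = *-cong-mod x≈y (^-cong-mod n x≈y)

    %-≈ : .{{_ : NonZero p}} → ∀ {m n} → m % p ≡ n % p → + m ≈ + n mod p
    %-≈ {m} {n} m%p≡n%p = mk≈ (divides (+ (m / p) - + (n / p)) (begin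
        + m - + n
          ≡⟨ cong₂ _-_ (split m) (split n) ⟩
        (+ (m % p) + + (m / p) * + p) - (+ (n % p) + + (n / p) * + p)
          ≡⟨ cong (λ r → (+ r + + (m / p) * + p) - (+ (n % p) + + (n / p) * + p)) m%p≡n%p ⟩
        (+ (n % p) + + (m / p) * + p) - (+ (n % p) + + (n / p) * + p)
          ≡⟨ cancel (+ (n % p)) (+ (m / p)) (+ (n / p)) (+ p) ⟩
        (+ (m / p) - + (n / p)) * + p ∎))
      where
        open ≡-Reasoning
        split : ∀ m → + m ≡ + (m % p) + + (m / p) * + p
        split m = begin
          + m                             ≡⟨ cong +_ (m≡m%n+[m/n]*n m p) ⟩
          + (m % p ℕ.+ m / p ℕ.* p)       ≡⟨ ℤ.pos-+ (m % p) _ ⟩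
          + (m % p) + + (m / p ℕ.* p)     ≡⟨ cong (λ z → + (m % p) + z) (ℤ.pos-* (m / p) p) ⟩
          + (m % p) + + (m / p) * + p     ∎
        cancel : ∀ r a b q → (r + a * q) - (r + b * q) ≡ (a - b) * q
        cancel = solve-∀

    module _ (p-prime : Prime p) where

      prime∣*⇒∣⊎∣ : ∀ x y → + p ∣ x * y → + p ∣ x ⊎ + p ∣ y
      prime∣*⇒∣⊎∣ x y p∣xy
        with euclidsLemma ℤ.∣ x ∣ ℤ.∣ y ∣ p-prime (subst (p ℕ.∣_) (ℤ.abs-* x y) (∣⇒∣ᵤ p∣xy))
      ... | inj₁ p∣x = inj₁ (∣ᵤ⇒∣ p∣x)
      ... | inj₂ p∣y = inj₂ (∣ᵤ⇒∣ p∣y)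

      prime∤1 : ¬ + p ∣ + 1
      prime∤1 p∣1 with ℕ.∣1⇒≡1 (∣⇒∣ᵤ p∣1)
      ... | refl with ℕ.nonTrivial⇒n>1 p {{prime⇒nonTrivial p-prime}}
      ... | s≤s ()

  ∣⇒∣^ : ∀ {p x n} → + p ∣ x → 1 ℕ.≤ n → + p ∣ x ℤ.^ n
  ∣⇒∣^ {x = x} {suc n} p∣x _ = ∣m⇒∣m*n (x ℤ.^ n) p∣x


module MonicPolynomials where

  open Congruence
  open import Data.Nat as ℕ using (ℕ; zero; suc; z≤n; s≤s)
  open import Data.Nat.Primality using (Prime)
  open import Data.Integer as ℤ using (ℤ; +_; _+_; _*_; _-_)
  import Data.Integer.Properties as ℤ
  open import Data.Integer.Divisibility.Signed using (_∣_; ∣m∣n⇒∣m-n)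
  open import Data.Integer.Tactic.RingSolver using (solve-∀)
  open import Data.Vec using (Vec; []; _∷_; zipWith; map; replicate)
  open import Data.List using (List; []; _∷_; length)
  open import Data.List.Relation.Unary.All as All using (All; []; _∷_)
  open import Data.List.Relation.Unary.AllPairs using (AllPairs; []; _∷_)
  open import Data.Product using (_,_)
  open import Data.Sum using (inj₁; inj₂)
  open import Data.Empty using (⊥-elim)
  open import Relation.Nullary using (¬_)
  open import Relation.Binary.PropositionalEquality

  -- A monic polynomial of degree d is the vector of its d lower coefficients, constant term first.
  evalMonic : ∀ {d} → Vec ℤ d → ℤ → ℤ
  evalMonic []       y = + 1
  evalMonic (c ∷ cs) y = c + y * evalMonic cs y

  eval : ∀ {d} → Vec ℤ d → ℤ → ℤ
  eval []       y = + 0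
  eval (c ∷ cs) y = c + y * eval cs y

  allCoefficients : ∀ {d} → Vec ℤ d → Vec ℤ (suc d)
  allCoefficients []       = + 1 ∷ []
  allCoefficients (c ∷ cs) = c ∷ allCoefficients cs

  eval-allCoefficients : ∀ {d} (f : Vec ℤ d) y → eval (allCoefficients f) y ≡ evalMonic f y
  eval-allCoefficients []       y = lemma y
    where lemma : ∀ y → + 1 + y * + 0 ≡ + 1
          lemma = solve-∀
  eval-allCoefficients (c ∷ cs) y = cong (λ z → c + y * z) (eval-allCoefficients cs y)

  evalMonic-+ : ∀ {d} (f g : Vec ℤ d) y → evalMonic (zipWith _+_ f g) y ≡ evalMonic f y + eval g y
  evalMonic-+ []       []       y = refl
  evalMonic-+ (c ∷ cs) (e ∷ es) y = begin
    (c + e) + y * evalMonic (zipWith _+_ cs es) y ≡⟨ cong (λ z → (c + e) + y * z) (evalMonic-+ cs es y) ⟩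
    (c + e) + y * (evalMonic cs y + eval es y)    ≡⟨ regroup c e y (evalMonic cs y) (eval es y) ⟩
    (c + y * evalMonic cs y) + (e + y * eval es y) ∎
    where
      open ≡-Reasoning
      regroup : ∀ c e y m g → (c + e) + y * (m + g) ≡ (c + y * m) + (e + y * g)
      regroup = solve-∀

  eval-scale : ∀ {d} r (g : Vec ℤ d) y → eval (map (r *_) g) y ≡ r * eval g y
  eval-scale r []       y = sym (ℤ.*-zeroʳ r)
  eval-scale r (e ∷ es) y = begin
    r * e + y * eval (map (r *_) es) y ≡⟨ cong (λ z → r * e + y * z) (eval-scale r es y) ⟩
    r * e + y * (r * eval es y)        ≡⟨ factor r e y (eval es y) ⟩
    r * (e + y * eval es y)            ∎
    where
      open ≡-Reasoning
      factor : ∀ r e y g → r * e + y * (r * g) ≡ r * (e + y * g)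
      factor = solve-∀

  -- Synthetic division: if f = c + X g then f(y) - f(r) = (y - r) (g(y) + r q(y)) with q = quotient g r.
  quotient : ∀ {d} → Vec ℤ (suc d) → ℤ → Vec ℤ d
  quotient (c ∷ [])           r = []
  quotient (c ∷ cs@(_ ∷ _)) r = zipWith _+_ cs (map (r *_) (allCoefficients (quotient cs r)))

  evalMonic-quotient : ∀ {d} (f : Vec ℤ (suc d)) y r →
    evalMonic f y - evalMonic f r ≡ (y - r) * evalMonic (quotient f r) y
  evalMonic-quotient (c ∷ [])           y r = linear c y r
    where linear : ∀ c y r → (c + y * + 1) - (c + r * + 1) ≡ (y - r) * + 1
          linear = solve-∀
  evalMonic-quotient (c ∷ cs@(_ ∷ _)) y r = begin
    (c + y * G) - (c + r * evalMonic cs r)  ≡⟨ split c y r G (evalMonic cs r) ⟩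
    (y - r) * G + r * (G - evalMonic cs r)  ≡⟨ cong (λ z → (y - r) * G + r * z) (evalMonic-quotient cs y r) ⟩
    (y - r) * G + r * ((y - r) * Q)         ≡⟨ factor y r G Q ⟩
    (y - r) * (G + r * Q)                   ≡⟨ cong (λ z → (y - r) * (G + z)) rQ ⟨
    (y - r) * (G + eval R y)                ≡⟨ cong ((y - r) *_) (evalMonic-+ cs R y) ⟨
    (y - r) * evalMonic (quotient (c ∷ cs) r) y ∎
    where
      open ≡-Reasoning
      G Q : ℤ
      G = evalMonic cs y
      Q = evalMonic (quotient cs r) y
      R : Vec ℤ _
      R = map (r *_) (allCoefficients (quotient cs r))
      split : ∀ c y r G g → (c + y * G) - (c + r * g) ≡ (y - r) * G + r * (G - g)
      split = solve-∀
      factor : ∀ y r G Q → (y - r) * G + r * ((y - r) * Q) ≡ (y - r) * (G + r * Q)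
      factor = solve-∀
      rQ : eval R y ≡ r * Q
      rQ = trans (eval-scale r (allCoefficients (quotient cs r)) y) (cong (r *_) (eval-allCoefficients (quotient cs r) y))

  module _ {p : ℕ} (p-prime : Prime p) where

    roots≤degree : ∀ {d} (f : Vec ℤ d) {ys : List ℤ} → AllPairs (λ y z → ¬ y ≈ z mod p) ys →
                   All (λ y → + p ∣ evalMonic f y) ys → length ys ℕ.≤ d
    roots≤degree f        {[]}     _           _            = z≤n
    roots≤degree []       {y ∷ ys} _           (p∣1 ∷ _)    = ⊥-elim (prime∤1 p-prime p∣1)
    roots≤degree (c ∷ cs) {y ∷ ys} (y≉ys ∷ ys≉) (f[y] ∷ f[ys]) =
      s≤s (roots≤degree (quotient f y) ys≉ (All.zipWith (λ (y≉z , f[z]) → quotient-root y≉z f[z]) (y≉ys , f[ys])))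
      where
        f : Vec ℤ _
        f = c ∷ cs
        quotient-root : ∀ {z} → ¬ y ≈ z mod p → + p ∣ evalMonic f z → + p ∣ evalMonic (quotient f y) z
        quotient-root {z} y≉z f[z] with prime∣*⇒∣⊎∣ p-prime (z - y) _
          (subst (+ p ∣_) (evalMonic-quotient f z y) (∣m∣n⇒∣m-n f[z] f[y]))
        ... | inj₁ p∣z-y = ⊥-elim (y≉z (≈-sym (mk≈ p∣z-y)))
        ... | inj₂ p∣q[z] = p∣q[z]

  evalMonic-X^n+c : ∀ c n y → evalMonic (c ∷ replicate n (+ 0)) y ≡ c + y ℤ.^ suc n
  evalMonic-X^n+c c n y = cong (λ z → c + y * z) (X^n n)
    where X^n : ∀ n → evalMonic (replicate n (+ 0)) y ≡ y ℤ.^ n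
          X^n zero    = refl
          X^n (suc n) = trans (ℤ.+-identityˡ _) (cong (y *_) (X^n n))


module Multiplicity where

  open import Data.Nat
  open import Data.Nat.Properties
  open import Data.Nat.Divisibility
  open import Data.Nat.Primality
  open import Data.Nat.Primality.Factorisation
  open PrimeFactorisation
  open import Data.Nat.ListAction using (product)
  open import Data.Nat.ListAction.Properties using (product-++; ∈⇒∣product)
  open import Data.List using (List; []; _∷_; _++_; map; filter)
  open import Data.List.Membership.Propositional using (_∈_)
  open import Data.List.Relation.Unary.Any using (here; there)
  open import Data.List.Relation.Unary.All as All using (All; []; _∷_)
  import Data.List.Relation.Unary.All.Properties as All
  open import Data.List.Relation.Binary.Permutation.Propositional using (_↭_; refl; prep; swap; trans)
  open import Data.Product using (_×_; _,_; proj₂)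
  open import Relation.Nullary using (yes; no)
  open import Relation.Unary using (Pred; Decidable)
  open import Data.Empty using (⊥-elim)
  open import Function using (_∘_)
  open import Algebra.Properties.CommutativeSemigroup +-commutativeSemigroup using (x∙yz≈y∙xz)
  open import Relation.Binary.PropositionalEquality as ≡ using (_≡_; _≢_; cong; cong₂; sym; subst)

  indicator : ℕ → ℕ → ℕ
  indicator c x with c ≟ x
  ... | yes _ = 1
  ... | no  _ = 0

  indicator-refl : ∀ c → indicator c c ≡ 1
  indicator-refl c with c ≟ c
  ... | yes _   = ≡.refl
  ... | no c≢c = ⊥-elim (c≢c ≡.refl)

  indicator-≢ : ∀ {c x} → c ≢ x → indicator c x ≡ 0
  indicator-≢ {c} {x} c≢x with c ≟ x
  ... | yes c≡x = ⊥-elim (c≢x c≡x)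
  ... | no  _   = ≡.refl

  count : ℕ → List ℕ → ℕ
  count c []       = 0
  count c (x ∷ xs) = indicator c x + count c xs

  count-++ : ∀ c xs ys → count c (xs ++ ys) ≡ count c xs + count c ys
  count-++ c []       ys = ≡.refl
  count-++ c (x ∷ xs) ys = ≡.trans (cong (indicator c x +_) (count-++ c xs ys)) (sym (+-assoc (indicator c x) _ _))

  count-↭ : ∀ c {xs ys} → xs ↭ ys → count c xs ≡ count c ys
  count-↭ c refl         = ≡.refl
  count-↭ c (prep x p)   = cong (indicator c x +_) (count-↭ c p)
  count-↭ c (swap {xs} {ys} x y p) = begin
    indicator c x + (indicator c y + count c xs) ≡⟨ x∙yz≈y∙xz (indicator c x) (indicator c y) (count c xs) ⟩
    indicator c y + (indicator c x + count c xs) ≡⟨ cong (λ n → indicator c y + (indicator c x + n)) (count-↭ c p) ⟩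
    indicator c y + (indicator c x + count c ys) ∎
    where open ≡.≡-Reasoning
  count-↭ c (trans p q)  = ≡.trans (count-↭ c p) (count-↭ c q)

  count>0⇒∈ : ∀ {c} xs → 1 ≤ count c xs → c ∈ xs
  count>0⇒∈ {c} (x ∷ xs) pos with c ≟ x
  ... | yes c≡x = here c≡x
  ... | no  _   = there (count>0⇒∈ xs pos)

  count-filter : ∀ {ℓ} {P : Pred ℕ ℓ} (P? : Decidable P) {c} → P c → ∀ xs → count c (filter P? xs) ≡ count c xs
  count-filter P? Pc []       = ≡.refl
  count-filter P? {c} Pc (x ∷ xs) with P? x
  ... | yes _  = cong (indicator c x +_) (count-filter P? Pc xs)
  ... | no ¬Px = ≡.trans (count-filter P? Pc xs) (cong (_+ count c xs) (sym (indicator-≢ λ where ≡.refl → ¬Px Pc)))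

  count-map : ∀ {S} (f : ℕ → ℕ) → (∀ {x y} → x ∈ S → y ∈ S → f x ≡ f y → x ≡ y) →
              ∀ {c} → c ∈ S → ∀ {ys} → All (_∈ S) ys → count (f c) (map f ys) ≡ count c ys
  count-map f injective c∈S []             = ≡.refl
  count-map f injective {c} c∈S {y ∷ ys} (y∈S ∷ ys⊆S) = cong₂ _+_ indicator-map (count-map f injective c∈S ys⊆S)
    where
      indicator-map : indicator (f c) (f y) ≡ indicator c y
      indicator-map with c ≟ y
      ... | yes ≡.refl = indicator-refl (f c)
      ... | no  c≢y    = indicator-≢ (c≢y ∘ injective c∈S y∈S)

  primeFactors : ℕ → List ℕ
  primeFactors zero        = []
  primeFactors n@(suc _)   = factors (factorise n)

  primeFactors-prime : ∀ n → All Prime (primeFactors n)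
  primeFactors-prime zero        = []
  primeFactors-prime n@(suc _)   = factorsPrime (factorise n)

  product-primeFactors : ∀ {n} → 1 ≤ n → product (primeFactors n) ≡ n
  product-primeFactors {n@(suc _)} _ = sym (isFactorisation (factorise n))

  prime⇒1<p : ∀ {q} → Prime q → 1 < q
  prime⇒1<p {q} q-prime = nonTrivial⇒n>1 q {{prime⇒nonTrivial q-prime}}

  -- Junk value: multiplicity c 0 = 0.
  multiplicity : ℕ → ℕ → ℕ
  multiplicity c n = count c (primeFactors n)

  multiplicity-factorisation : ∀ {n} c (f : PrimeFactorisation n) → 1 ≤ n →
                               multiplicity c n ≡ count c (factors f)
  multiplicity-factorisation {suc n} c f _ = count-↭ c (factorisationUnique (factorise (suc n)) f)

  factorisation-* : ∀ {m n} → PrimeFactorisation m → PrimeFactorisation n → PrimeFactorisation (m * n)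
  factorisation-* f g = record
    { factors         = factors f ++ factors g
    ; isFactorisation = ≡.trans (cong₂ _*_ (isFactorisation f) (isFactorisation g)) (sym (product-++ (factors f) (factors g)))
    ; factorsPrime    = All.++⁺ (factorsPrime f) (factorsPrime g)
    }

  multiplicity-* : ∀ {m n} c → 1 ≤ m → 1 ≤ n → multiplicity c (m * n) ≡ multiplicity c m + multiplicity c n
  multiplicity-* {suc m} {suc n} c _ _ =
    ≡.trans (multiplicity-factorisation c (factorisation-* (factorise (suc m)) (factorise (suc n))) (s≤s z≤n))
            (count-++ c (factors (factorise (suc m))) _)

  multiplicity-^ : ∀ {n} c e → 1 ≤ n → multiplicity c (n ^ e) ≡ e * multiplicity c n
  multiplicity-^         c zero    _   = ≡.refl
  multiplicity-^ {n} c (suc e) 1≤n = ≡.trans (multiplicity-* c 1≤n (m^n>0 n {{>-nonZero 1≤n}} e))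
                                             (cong (multiplicity c n +_) (multiplicity-^ c e 1≤n))

  multiplicity-prime : ∀ {q} c → Prime q → multiplicity c q ≡ indicator c q
  multiplicity-prime {q} c q-prime =
    ≡.trans (multiplicity-factorisation c (primeFactorisation[p] q-prime) (<⇒≤ (prime⇒1<p q-prime))) (+-identityʳ _)

  multiplicity>0⇒prime∣ : ∀ {c n} → 1 ≤ n → 1 ≤ multiplicity c n → Prime c × c ∣ n
  multiplicity>0⇒prime∣ {c} {n} 1≤n pos =
    All.lookup (primeFactors-prime n) c∈ , subst (c ∣_) (product-primeFactors 1≤n) (∈⇒∣product c∈)
    where
      c∈ : c ∈ primeFactors n
      c∈ = count>0⇒∈ (primeFactors n) pos

  multiplicity-beyond : ∀ {c n} → n < c → multiplicity c n ≡ 0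
  multiplicity-beyond {c} {zero}  _   = ≡.refl
  multiplicity-beyond {c} {suc n} n<c with multiplicity c (suc n) in eq
  ... | zero  = ≡.refl
  ... | suc _ = ⊥-elim (<⇒≱ n<c (∣⇒≤ (proj₂ (multiplicity>0⇒prime∣ (s≤s z≤n) 1≤multiplicity))))
    where 1≤multiplicity : 1 ≤ multiplicity c (suc n)
          1≤multiplicity = subst (1 ≤_) (sym eq) (s≤s z≤n)

  count≤multiplicity⇒product∣ : ∀ {n} xs → All Prime xs → 1 ≤ n → (∀ c → count c xs ≤ multiplicity c n) → product xs ∣ n
  count≤multiplicity⇒product∣ []       _                    _   _       = 1∣ _
  count≤multiplicity⇒product∣ {n} (x ∷ xs) (x-prime ∷ xs-prime) 1≤n bounded
    with multiplicity>0⇒prime∣ 1≤n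
           (≤-trans (subst (λ i → 1 ≤ i + count x xs) (sym (indicator-refl x)) (s≤s z≤n)) (bounded x))
  ... | _ , divides zero    n≡0 = ⊥-elim (<⇒≢ 1≤n (sym n≡0))
  ... | _ , divides (suc q) n≡q*x =
    subst (x * product xs ∣_) (sym (≡.trans n≡q*x (*-comm (suc q) x)))
          (*-monoʳ-∣ x (count≤multiplicity⇒product∣ xs xs-prime (s≤s z≤n) bounded′))
    where
      bounded′ : ∀ c → count c xs ≤ multiplicity c (suc q)
      bounded′ c = +-cancelˡ-≤ (indicator c x) _ _ (subst (indicator c x + count c xs ≤_) (begin
        multiplicity c n                                   ≡⟨ cong (multiplicity c) n≡q*x ⟩
        multiplicity c (suc q * x)                         ≡⟨ multiplicity-* {suc q} c (s≤s z≤n) (<⇒≤ (prime⇒1<p x-prime)) ⟩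
        multiplicity c (suc q) + multiplicity c x          ≡⟨ +-comm (multiplicity c (suc q)) _ ⟩
        multiplicity c x + multiplicity c (suc q)          ≡⟨ cong (_+ multiplicity c (suc q)) (multiplicity-prime c x-prime) ⟩
        indicator c x + multiplicity c (suc q)             ∎) (bounded c))
        where open ≡.≡-Reasoning

  multiplicity-injective : ∀ {m n} → 1 ≤ m → 1 ≤ n → (∀ c → multiplicity c m ≡ multiplicity c n) → m ≡ n
  multiplicity-injective 1≤m 1≤n same = ∣-antisym (multiplicity≡⇒∣ 1≤m 1≤n same)
                                                  (multiplicity≡⇒∣ 1≤n 1≤m (λ c → sym (same c)))
    where
      multiplicity≡⇒∣ : ∀ {m n} → 1 ≤ m → 1 ≤ n → (∀ c → multiplicity c m ≡ multiplicity c n) → m ∣ n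
      multiplicity≡⇒∣ {m} 1≤m 1≤n same =
        subst (_∣ _) (product-primeFactors 1≤m)
              (count≤multiplicity⇒product∣ (primeFactors m) (primeFactors-prime m) 1≤n (≤-reflexive ∘ same))


module LinearAlgebra where

  open import Data.Nat as ℕ using (ℕ; zero; suc; z≤n; s≤s)
  open import Data.Integer as ℤ using (ℤ; _+_; _*_; _-_; -_; 0ℤ; 1ℤ; -1ℤ)
  import Data.Integer.Properties as ℤ
  open import Data.Integer.Tactic.RingSolver using (solve-∀)
  open import Algebra.Properties.Semiring.Sum ℤ.+-*-semiring
    using (sum; ∑-distrib-+; *-distribˡ-sum; sum-cong-≗; sum-replicate-zero)
  open import Algebra.Properties.AbelianGroup ℤ.+-0-abelianGroup using (inverseʳ-unique)
  open import Data.Fin using (Fin; zero; suc)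
  open import Data.Fin.Properties using (all?; ¬∀⟶∃¬)
  import Data.Vec.Functional as Vector
  open import Data.List using (List; []; _∷_; length)
  open import Data.List.Membership.Propositional using (_∈_)
  open import Data.List.Relation.Unary.Any using (here; there)
  open import Data.List.Relation.Unary.All as All using (All; []; _∷_)
  open import Data.List.Relation.Unary.Unique.Propositional using (Unique; []; _∷_)
  open import Data.Product using (Σ; ∃; _×_; _,_)
  open import Data.Sum using (_⊎_; inj₁; inj₂)
  open import Data.Empty using (⊥-elim)
  open import Function using (_∘_)
  open import Relation.Nullary using (yes; no)
  open import Relation.Binary.PropositionalEquality

  Matrix : ℕ → ℕ → Set
  Matrix n B = Fin n → Fin B → ℤ

  combination : ∀ {n B} → (Fin n → ℤ) → Matrix n B → Fin B → ℤ
  combination e V c = sum (λ i → e i * V i c)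

  LinearlyIndependent : ∀ {n B} → Matrix n B → Set
  LinearlyIndependent V = ∀ e → (∀ c → combination e V c ≡ 0ℤ) → ∀ i → e i ≡ 0ℤ

  Determining : ∀ {n B} → List (Fin B) → Matrix n B → Set
  Determining S V = ∀ e → (∀ c → c ∈ S → combination e V c ≡ 0ℤ) → ∀ c → combination e V c ≡ 0ℤ

  NonzeroColumn : ∀ {n B} → Matrix n B → Fin B → Set
  NonzeroColumn V c = ∃ λ i → V i c ≢ 0ℤ

  FewDeterminingColumns : ∀ {n B} → ℕ → Matrix n B → Set
  FewDeterminingColumns m V =
    Σ (List _) λ S → length S ℕ.≤ m × Unique S × All (NonzeroColumn V) S × Determining S V

  IndependentRows : ∀ {n B} → ℕ → Matrix n B → Set
  IndependentRows {n} m V = Σ (Fin m → Fin n) λ σ → LinearlyIndependent (V ∘ σ)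

  combination-zero : ∀ {n B} (V : Matrix n B) c → combination (λ _ → 0ℤ) V c ≡ 0ℤ
  combination-zero {n} V c = trans (sum-cong-≗ (λ i → ℤ.*-zeroˡ (V i c))) (sum-replicate-zero n)

  combination-of-zero : ∀ {n B} e c → combination e (λ (_ : Fin n) (_ : Fin B) → 0ℤ) c ≡ 0ℤ
  combination-of-zero {n} e c = trans (sum-cong-≗ (λ i → ℤ.*-zeroʳ (e i))) (sum-replicate-zero n)

  combination-− : ∀ {n B} e f (V : Matrix n B) c →
    combination (λ j → e j - f j) V c ≡ combination e V c - combination f V c
  combination-− {n} e f V c = begin
    sum (λ j → (e j - f j) * V j c)
      ≡⟨ sum-cong-≗ (λ j → expand (e j) (f j) (V j c)) ⟩
    sum (λ j → e j * V j c + -1ℤ * (f j * V j c))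
      ≡⟨ ∑-distrib-+ (λ j → e j * V j c) (λ j → -1ℤ * (f j * V j c)) ⟩
    combination e V c + sum (λ j → -1ℤ * (f j * V j c))
      ≡⟨ cong (λ x → combination e V c + x) (*-distribˡ-sum -1ℤ (λ j → f j * V j c)) ⟨
    combination e V c + -1ℤ * combination f V c
      ≡⟨ collect (combination e V c) (combination f V c) ⟩
    combination e V c - combination f V c ∎
    where
      open ≡-Reasoning
      expand : ∀ e f v → (e - f) * v ≡ e * v + -1ℤ * (f * v)
      expand = solve-∀
      collect : ∀ x y → x + -1ℤ * y ≡ x - y
      collect = solve-∀

  unit : ∀ {n} → Fin n → Fin n → ℤ
  unit zero    zero    = 1ℤ
  unit zero    (suc _) = 0ℤ
  unit (suc _) zero    = 0ℤ
  unit (suc i) (suc j) = unit i j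

  combination-unit : ∀ {n B} (i : Fin n) (V : Matrix n B) c → combination (unit i) V c ≡ V i c
  combination-unit zero    V c = begin
    1ℤ * V zero c + sum (λ j → 0ℤ * V (suc j) c) ≡⟨ cong (λ x → 1ℤ * V zero c + x) (combination-zero (V ∘ suc) c) ⟩
    1ℤ * V zero c + 0ℤ                            ≡⟨ ℤ.+-identityʳ _ ⟩
    1ℤ * V zero c                                 ≡⟨ ℤ.*-identityˡ _ ⟩
    V zero c                                      ∎
    where open ≡-Reasoning
  combination-unit (suc i) V c = trans (cong (λ x → 0ℤ * V zero c + x) (combination-unit i (V ∘ suc) c)) (ℤ.+-identityˡ _)

  -- One step of Gaussian elimination with pivot v c: column c of the result vanishes.
  clear : ∀ {n B} → Matrix n B → (Fin B → ℤ) → Fin B → Matrix n B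
  clear V v c j c′ = v c * V j c′ - V j c * v c′

  combination-clear : ∀ {n B} e (V : Matrix n B) v c c′ →
    combination e (clear V v c) c′ ≡ v c * combination e V c′ - combination e V c * v c′
  combination-clear {n} e V v c c′ = begin
    sum (λ j → e j * (v c * V j c′ - V j c * v c′))
      ≡⟨ sum-cong-≗ (λ j → expand (e j) (v c) (v c′) (V j c′) (V j c)) ⟩
    sum (λ j → v c * (e j * V j c′) + (- v c′) * (e j * V j c))
      ≡⟨ ∑-distrib-+ (λ j → v c * (e j * V j c′)) (λ j → (- v c′) * (e j * V j c)) ⟩
    sum (λ j → v c * (e j * V j c′)) + sum (λ j → (- v c′) * (e j * V j c))
      ≡⟨ sym (cong₂ _+_ (*-distribˡ-sum (v c) (λ j → e j * V j c′)) (*-distribˡ-sum (- v c′) (λ j → e j * V j c))) ⟩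
    v c * combination e V c′ + (- v c′) * combination e V c
      ≡⟨ collect (v c) (v c′) _ _ ⟩
    v c * combination e V c′ - combination e V c * v c′ ∎
    where
      open ≡-Reasoning
      expand : ∀ e a w x y → e * (a * x - y * w) ≡ a * (e * x) + (- w) * (e * y)
      expand = solve-∀
      collect : ∀ a w X Y → a * X + (- w) * Y ≡ a * X - Y * w
      collect = solve-∀

  *-cancel-≢0 : ∀ {a x} → a ≢ 0ℤ → a * x ≡ 0ℤ → x ≡ 0ℤ
  *-cancel-≢0 {a} {x} a≢0 ax≡0 with ℤ.i*j≡0⇒i≡0∨j≡0 a ax≡0
  ... | inj₁ a≡0 = ⊥-elim (a≢0 a≡0)
  ... | inj₂ x≡0 = x≡0

  module Pivot {n B} (V : Matrix n B) {i : Fin n} {c : Fin B} (pivot≢0 : V i c ≢ 0ℤ) where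

    private
      v : Fin B → ℤ
      v = V i
      V′ : Matrix n B
      V′ = clear V v c

    single-independent : LinearlyIndependent (λ (_ : Fin 1) → v)
    single-independent e vanishes zero = *-cancel-≢0 pivot≢0
      (trans (ℤ.*-comm (v c) (e zero)) (trans (sym (ℤ.+-identityʳ _)) (vanishes c)))

    -- e₀ v + Σ eⱼ Vσⱼ = 0 forces Σ eⱼ V′σⱼ = 0, hence e = 0 by independence of the V′σⱼ.
    extend-independent : ∀ {m} (σ : Fin m → Fin n) → LinearlyIndependent (V′ ∘ σ) →
                         LinearlyIndependent (V ∘ (i Vector.∷ σ))
    extend-independent σ independent e vanishes = λ { zero → e₀≡0 ; (suc j) → tail≡0 j }
      where
        rest : Fin B → ℤ
        rest = combination (e ∘ suc) (V ∘ σ)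
        rest≡ : ∀ c′ → rest c′ ≡ - (e zero * v c′)
        rest≡ c′ = inverseʳ-unique (e zero * v c′) (rest c′) (vanishes c′)
        tail≡0 : ∀ j → e (suc j) ≡ 0ℤ
        tail≡0 = independent (e ∘ suc) λ c′ → begin
          combination (e ∘ suc) (V′ ∘ σ) c′                  ≡⟨ combination-clear (e ∘ suc) (V ∘ σ) v c c′ ⟩
          v c * rest c′ - rest c * v c′
                                                              ≡⟨ cong₂ (λ x y → v c * x - y * v c′) (rest≡ c′) (rest≡ c) ⟩
          v c * - (e zero * v c′) - - (e zero * v c) * v c′   ≡⟨ cancel (v c) (e zero) (v c′) ⟩
          0ℤ                                                  ∎
          where open ≡-Reasoning
                cancel : ∀ a e w → a * - (e * w) - - (e * a) * w ≡ 0ℤ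
                cancel = solve-∀
        e₀≡0 : e zero ≡ 0ℤ
        e₀≡0 = *-cancel-≢0 pivot≢0 (begin
          v c * e zero
            ≡⟨ ℤ.*-comm (v c) (e zero) ⟩
          e zero * v c
            ≡⟨ sym (ℤ.+-identityʳ _) ⟩
          e zero * v c + 0ℤ
            ≡⟨ cong (λ x → e zero * v c + x) rest[c]≡0 ⟨
          e zero * v c + rest c
            ≡⟨ vanishes c ⟩
          0ℤ ∎)
          where
            open ≡-Reasoning
            rest[c]≡0 : rest c ≡ 0ℤ
            rest[c]≡0 = trans (sum-cong-≗ (λ j → cong (_* V (σ j) c) (tail≡0 j))) (combination-zero (V ∘ σ) c)

    extend-determining : ∀ {m} → FewDeterminingColumns m V′ → FewDeterminingColumns (suc m) V
    extend-determining (S , |S|≤m , unique , nonzero , determining) =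
      c ∷ S , s≤s |S|≤m , All.map c≢ nonzero ∷ unique , (i , pivot≢0) ∷ All.map nonzero-in-V nonzero , determining′
      where
        c≢ : ∀ {c″} → NonzeroColumn V′ c″ → c ≢ c″
        c≢ (j , V′jc≢0) refl = V′jc≢0 (cleared (v c) (V j c))
          where cleared : ∀ a x → a * x - x * a ≡ 0ℤ
                cleared = solve-∀
        nonzero-in-V : ∀ {c″} → NonzeroColumn V′ c″ → NonzeroColumn V c″
        nonzero-in-V {c″} (j , V′jc″≢0) with V j c″ ℤ.≟ 0ℤ | v c″ ℤ.≟ 0ℤ
        ... | no  Vjc″≢0 | _          = j , Vjc″≢0
        ... | yes _      | no  vc″≢0  = i , vc″≢0
        ... | yes Vjc″≡0 | yes vc″≡0  =
          ⊥-elim (V′jc″≢0 (trans (cong₂ (λ x y → v c * x - V j c * y) Vjc″≡0 vc″≡0) (zeros (v c) (V j c))))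
          where zeros : ∀ a y → a * 0ℤ - y * 0ℤ ≡ 0ℤ
                zeros = solve-∀
        determining′ : Determining (c ∷ S) V
        determining′ e vanishes c′ = *-cancel-≢0 pivot≢0 (begin
          v c * combination e V c′
            ≡⟨ drop-zero (v c) _ (v c′) ⟨
          v c * combination e V c′ - 0ℤ * v c′
            ≡⟨ cong (λ y → v c * combination e V c′ - y * v c′) (vanishes c (here refl)) ⟨
          v c * combination e V c′ - combination e V c * v c′
            ≡⟨ combination-clear e V v c c′ ⟨
          combination e V′ c′
            ≡⟨ determining e vanishes′ c′ ⟩
          0ℤ ∎)
          where
            open ≡-Reasoning
            drop-zero : ∀ a x w → a * x - 0ℤ * w ≡ a * x
            drop-zero = solve-∀
            vanishes′ : ∀ c″ → c″ ∈ S → combination e V′ c″ ≡ 0ℤ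
            vanishes′ c″ c″∈S = begin
              combination e V′ c″
                ≡⟨ combination-clear e V v c c″ ⟩
              v c * combination e V c″ - combination e V c * v c″
                ≡⟨ cong₂ (λ x y → v c * x - y * v c″) (vanishes c″ (there c″∈S)) (vanishes c (here refl)) ⟩
              v c * 0ℤ - 0ℤ * v c″
                ≡⟨ zeros (v c) (v c″) ⟩
              0ℤ ∎
              where zeros : ∀ a w → a * 0ℤ - 0ℤ * w ≡ 0ℤ
                    zeros = solve-∀

  independentRows⊎determiningColumns : ∀ m {n B} (V : Matrix n B) → IndependentRows (suc m) V ⊎ FewDeterminingColumns m V
  independentRows⊎determiningColumns m {n} {B} V with all? (λ i → all? (λ c → V i c ℤ.≟ 0ℤ))
  ... | yes V≡0 =
    inj₂ ([] , z≤n , [] , [] , λ e _ c → trans (sum-cong-≗ (λ i → cong (e i *_) (V≡0 i c))) (combination-of-zero e c))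
  ... | no  V≢0 with ¬∀⟶∃¬ n _ (λ i → all? (λ c → V i c ℤ.≟ 0ℤ)) V≢0
  ... | i , Vi≢0 with ¬∀⟶∃¬ B _ (λ c → V i c ℤ.≟ 0ℤ) Vi≢0
  ... | c , pivot≢0 with m
  ... | zero  = inj₁ ((λ _ → i) , Pivot.single-independent V pivot≢0)
  ... | suc m with independentRows⊎determiningColumns m (clear V (V i) c)
  ...   | inj₁ (σ , independent) = inj₁ (i Vector.∷ σ , Pivot.extend-independent V pivot≢0 σ independent)
  ...   | inj₂ few               = inj₂ (Pivot.extend-determining V pivot≢0 few)

  determining-rows : ∀ {n B} {S} {V : Matrix n B} → Determining S V →
    ∀ i i′ → (∀ c → c ∈ S → V i c ≡ V i′ c) → ∀ c → V i c ≡ V i′ c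
  determining-rows {S = S} {V} determining i i′ agree c =
    ℤ.i-j≡0⇒i≡j _ _ (trans (sym (row-difference c)) (determining (λ j → unit i j - unit i′ j) vanishes c))
    where
      row-difference : ∀ c → combination (λ j → unit i j - unit i′ j) V c ≡ V i c - V i′ c
      row-difference c = trans (combination-− (unit i) (unit i′) V c) (cong₂ _-_ (combination-unit i V c) (combination-unit i′ V c))
      vanishes : ∀ c → c ∈ S → combination (λ j → unit i j - unit i′ j) V c ≡ 0ℤ
      vanishes c c∈S = trans (row-difference c) (trans (cong (λ x → V i c - x) (sym (agree c c∈S))) (ℤ.+-inverseʳ (V i c)))


module Lists where

  open import Data.Nat using (suc; z≤n; s≤s; _≤_; _+_)
  open import Data.Nat.Properties using (+-suc; module ≤-Reasoning)
  open import Data.List using (List; []; _∷_; _++_; length; map)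
  import Data.List.Properties as List
  open import Data.List.Membership.Propositional using (_∈_)
  open import Data.List.Membership.Propositional.Properties using (∈-∃++; ∈-++⁻; ∈-++⁺ˡ; ∈-++⁺ʳ)
  open import Data.List.Relation.Unary.Any using (here; there)
  open import Data.List.Relation.Unary.All as All using (All; []; _∷_)
  import Data.List.Relation.Unary.All.Properties as All
  open import Data.List.Relation.Unary.AllPairs using (AllPairs; []; _∷_)
  open import Data.List.Relation.Unary.Unique.Propositional using (Unique)
  open import Data.Product using (_×_; _,_)
  open import Data.Sum using (inj₁; inj₂)
  open import Data.Empty using (⊥-elim)
  open import Relation.Binary.PropositionalEquality

  allPairs-map-All : ∀ {A : Set} {P : A → Set} {R R′ : A → A → Set} {xs} →
    (∀ {x y} → P x → P y → R x y → R′ x y) → All P xs → AllPairs R xs → AllPairs R′ xs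
  allPairs-map-All f []         []         = []
  allPairs-map-All f (px ∷ pxs) (rx ∷ rxs) = All.zipWith (λ (py , r) → f px py r) (pxs , rx) ∷ allPairs-map-All f pxs rxs

  unique-⊆⇒length≤ : ∀ {A : Set} {xs ys : List A} → Unique xs → All (_∈ ys) xs → length xs ≤ length ys
  unique-⊆⇒length≤ {xs = []}     _                 _            = z≤n
  unique-⊆⇒length≤ {xs = x ∷ xs} (x∉xs ∷ xs-unique) (x∈ys ∷ xs⊆ys) with ∈-∃++ x∈ys
  ... | ys₁ , ys₂ , refl = begin
    suc (length xs)                ≤⟨ s≤s (unique-⊆⇒length≤ xs-unique (All.zipWith drop-x (x∉xs , xs⊆ys))) ⟩
    suc (length (ys₁ ++ ys₂))      ≡⟨ cong suc (List.length-++ ys₁) ⟩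
    suc (length ys₁ + length ys₂)  ≡⟨ +-suc (length ys₁) (length ys₂) ⟨
    length ys₁ + length (x ∷ ys₂)  ≡⟨ List.length-++ ys₁ ⟨
    length (ys₁ ++ x ∷ ys₂)        ∎
    where
      open ≤-Reasoning
      drop-x : ∀ {y} → x ≢ y × y ∈ ys₁ ++ x ∷ ys₂ → y ∈ ys₁ ++ ys₂
      drop-x (x≢y , y∈) with ∈-++⁻ ys₁ y∈
      ... | inj₁ y∈ys₁         = ∈-++⁺ˡ y∈ys₁
      ... | inj₂ (here y≡x)    = ⊥-elim (x≢y (sym y≡x))
      ... | inj₂ (there y∈ys₂) = ∈-++⁺ʳ ys₁ y∈ys₂

  injective⇒length≤ : ∀ {A B : Set} (f : A → B) {xs : List A} {ys : List B} → Unique xs →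
    (∀ {x y} → x ∈ xs → y ∈ xs → f x ≡ f y → x ≡ y) → All (λ x → f x ∈ ys) xs → length xs ≤ length ys
  injective⇒length≤ f {xs} xs-unique f-injective f[xs]⊆ys =
    subst (_≤ _) (List.length-map f xs) (unique-⊆⇒length≤ (map-unique xs-unique f-injective) (All.map⁺ f[xs]⊆ys))
    where
      map-unique : ∀ {xs} → Unique xs → (∀ {x y} → x ∈ xs → y ∈ xs → f x ≡ f y → x ≡ y) → Unique (map f xs)
      map-unique []                _         = []
      map-unique (x∉xs ∷ xs-unique) injective =
        All.map⁺ (All.tabulate λ y∈xs fx≡fy → All.lookup x∉xs y∈xs (injective (here refl) (there y∈xs) fx≡fy))
        ∷ map-unique xs-unique (λ x∈ y∈ → injective (there x∈) (there y∈))


module Compositions where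

  open import Data.Nat
  open import Data.Nat.Properties using (+-identityʳ; +-suc; +-comm)
  open import Data.Nat.Combinatorics using (_C_; nCn≡1; nCk+nC[k+1]≡[n+1]C[k+1])
  open import Data.Vec as Vec using (Vec; []; _∷_)
  open import Data.Vec.Properties using (∷-injectiveʳ)
  open import Data.List using (List; []; _∷_; _++_; length; map)
  import Data.List.Properties as List
  open import Data.List.Relation.Unary.All as All using (All; []; _∷_)
  import Data.List.Relation.Unary.All.Properties as All
  open import Data.List.Relation.Unary.AllPairs as AllPairs using ([]; _∷_)
  import Data.List.Relation.Unary.AllPairs.Properties as AllPairs
  open import Data.List.Relation.Unary.Unique.Propositional using (Unique)
  open import Function using (_∘_)
  open import Relation.Binary.PropositionalEquality

  incrementHead : ∀ {m} → Vec ℕ (suc m) → Vec ℕ (suc m)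
  incrementHead (x ∷ xs) = suc x ∷ xs

  -- The exponent vectors of the monomials of degree r in j + 1 variables.
  compositions : (j r : ℕ) → List (Vec ℕ (suc j))
  compositions zero    r       = (r ∷ []) ∷ []
  compositions (suc j) zero    = Vec.replicate (suc (suc j)) 0 ∷ []
  compositions (suc j) (suc r) = map incrementHead (compositions (suc j) r) ++ map (0 ∷_) (compositions j (suc r))

  length-compositions : ∀ j r → length (compositions j r) ≡ (r + j) C j
  length-compositions zero    r       = refl
  length-compositions (suc j) zero    = sym (nCn≡1 (suc j))
  length-compositions (suc j) (suc r) = begin
    length (map incrementHead (compositions (suc j) r) ++ map (0 ∷_) (compositions j (suc r)))
      ≡⟨ List.length-++ (map incrementHead (compositions (suc j) r)) ⟩
    length (map incrementHead (compositions (suc j) r)) + length (map (0 ∷_) (compositions j (suc r)))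
      ≡⟨ cong₂ _+_ (List.length-map incrementHead (compositions (suc j) r)) (List.length-map (0 ∷_) (compositions j (suc r))) ⟩
    length (compositions (suc j) r) + length (compositions j (suc r))
      ≡⟨ cong₂ _+_ (length-compositions (suc j) r) (length-compositions j (suc r)) ⟩
    (r + suc j) C suc j + (suc r + j) C j
      ≡⟨ cong (λ n → n C suc j + (suc r + j) C j) (+-suc r j) ⟩
    suc (r + j) C suc j + suc (r + j) C j
      ≡⟨ +-comm (suc (r + j) C suc j) _ ⟩
    suc (r + j) C j + suc (r + j) C suc j
      ≡⟨ nCk+nC[k+1]≡[n+1]C[k+1] (suc (r + j)) j ⟩
    suc (suc (r + j)) C suc j
      ≡⟨ cong (λ n → suc n C suc j) (+-suc r j) ⟨
    (suc r + suc j) C suc j ∎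
    where open ≡-Reasoning

  compositions-sum : ∀ j r → All (λ α → Vec.sum α ≡ r) (compositions j r)
  compositions-sum zero    r       = +-identityʳ r ∷ []
  compositions-sum (suc j) zero    = sum-replicate-0 (suc (suc j)) ∷ []
    where sum-replicate-0 : ∀ m → Vec.sum (Vec.replicate m 0) ≡ 0
          sum-replicate-0 zero    = refl
          sum-replicate-0 (suc m) = sum-replicate-0 m
  compositions-sum (suc j) (suc r) =
    All.++⁺ (All.map⁺ (All.map (λ {α} → sum-incrementHead α) (compositions-sum (suc j) r)))
            (All.map⁺ (compositions-sum j (suc r)))
    where sum-incrementHead : ∀ (α : Vec ℕ (suc (suc j))) → Vec.sum α ≡ r → Vec.sum (incrementHead α) ≡ suc r
          sum-incrementHead (x ∷ xs) = cong suc

  compositions-unique : ∀ j r → Unique (compositions j r)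
  compositions-unique zero    r       = [] ∷ []
  compositions-unique (suc j) zero    = [] ∷ []
  compositions-unique (suc j) (suc r) =
    AllPairs.++⁺ (AllPairs.map⁺ (AllPairs.map (λ α≢β → α≢β ∘ incrementHead-injective) (compositions-unique (suc j) r)))
                 (AllPairs.map⁺ (AllPairs.map (λ α≢β → α≢β ∘ ∷-injectiveʳ) (compositions-unique j (suc r))))
                 (All.map⁺ (All.tabulate λ {α} _ → All.map⁺ (All.tabulate λ _ → incrementHead≢0∷ α)))
    where
      incrementHead-injective : ∀ {m} {α β : Vec ℕ (suc m)} → incrementHead α ≡ incrementHead β → α ≡ β
      incrementHead-injective {α = _ ∷ _} {_ ∷ _} refl = refl
      incrementHead≢0∷ : ∀ (α : Vec ℕ (suc (suc j))) {β} → incrementHead α ≢ 0 ∷ β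
      incrementHead≢0∷ (_ ∷ _) ()


module PrimeAssignments where

  open Lists using (unique-⊆⇒length≤)
  open import Data.Nat
  open import Data.Nat.Properties
  open import Data.Nat.Primality using (Prime; prime?)
  open import Data.List using (List; []; _∷_; _++_; length; filter; upTo; [_])
  import Data.List.Properties as List
  open import Data.List.Membership.Propositional using (_∈_; find)
  open import Data.List.Membership.Propositional.Properties using (∈-filter⁺; ∈-upTo⁺)
  open import Data.List.Relation.Unary.Any as Any using (here; there)
  open import Data.List.Relation.Unary.All as All using (All; []; _∷_)
  import Data.List.Relation.Unary.All.Properties as All
  open import Data.List.Relation.Unary.AllPairs using (_∷_)
  open import Data.List.Relation.Unary.Unique.Propositional using (Unique)
  import Data.List.Relation.Unary.Unique.Propositional.Properties as Unique
  open import Data.Product using (_,_)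
  open import Data.Empty using (⊥-elim)
  open import Function using (_∘_)
  open import Relation.Nullary using (¬_; yes; no)
  open import Relation.Nullary.Decidable using (¬?)
  open import Relation.Binary.PropositionalEquality hiding ([_])

  primesBelow-suc : ∀ n → primesBelow (suc n) ≡ primesBelow n + length (filter prime? [ n ])
  primesBelow-suc n = begin
    length (filter prime? (upTo (suc n)))                   ≡⟨ cong (length ∘ filter prime?) (List.upTo-∷ʳ n) ⟨
    length (filter prime? (upTo n ++ [ n ]))                ≡⟨ cong length (List.filter-++ prime? (upTo n) [ n ]) ⟩
    length (filter prime? (upTo n) ++ filter prime? [ n ])  ≡⟨ List.length-++ (filter prime? (upTo n)) ⟩
    primesBelow n + length (filter prime? [ n ])            ∎
    where open ≡-Reasoning

  primesBelow-suc-prime : ∀ {n} → Prime n → primesBelow (suc n) ≡ suc (primesBelow n)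
  primesBelow-suc-prime {n} n-prime =
    trans (primesBelow-suc n) (trans (cong (λ ps → primesBelow n + length ps) (List.filter-accept prime? n-prime)) (+-comm _ 1))

  primesBelow-suc-¬prime : ∀ {n} → ¬ Prime n → primesBelow (suc n) ≡ primesBelow n
  primesBelow-suc-¬prime {n} n-¬prime =
    trans (primesBelow-suc n) (trans (cong (λ ps → primesBelow n + length ps) (List.filter-reject prime? n-¬prime)) (+-identityʳ _))

  record PrimeAssignment (Q : ℕ) (S : List ℕ) : Set where
    field
      ρ           : ℕ → ℕ
      ρ-prime     : ∀ {c} → c ∈ S → Prime (ρ c)
      ρ≤          : ∀ {c} → c ∈ S → ρ c ≤ c
      ρ≤Q         : ∀ {c} → c ∈ S → ρ c ≤ Q
      ρ-injective : ∀ {c c′} → c ∈ S → c′ ∈ S → ρ c ≡ ρ c′ → c ≡ c′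

  without : ℕ → List ℕ → List ℕ
  without c₀ = filter (¬? ∘ (_≟ c₀))

  weaken : ∀ {Q S} → PrimeAssignment Q S → PrimeAssignment (suc Q) S
  weaken a = record { PrimeAssignment a ; ρ≤Q = λ c∈S → m≤n⇒m≤1+n (PrimeAssignment.ρ≤Q a c∈S) }

  extend : ∀ {Q S c₀} → Prime (suc Q) → suc Q ≤ c₀ → PrimeAssignment Q (without c₀ S) →
           PrimeAssignment (suc Q) S
  extend {Q} {S} {c₀} Q+1-prime Q<c₀ a = record
    { ρ = ρ′ ; ρ-prime = ρ′-prime ; ρ≤ = ρ′≤ ; ρ≤Q = ρ′≤Q ; ρ-injective = ρ′-injective }
    where
      open PrimeAssignment a
      others : ∀ {c} → c ∈ S → c ≢ c₀ → c ∈ without c₀ S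
      others c∈S c≢c₀ = ∈-filter⁺ (¬? ∘ (_≟ c₀)) c∈S c≢c₀
      ρ′ : ℕ → ℕ
      ρ′ c with c ≟ c₀
      ... | yes _ = suc Q
      ... | no  _ = ρ c
      ρ′-prime : ∀ {c} → c ∈ S → Prime (ρ′ c)
      ρ′-prime {c} c∈S with c ≟ c₀
      ... | yes _    = Q+1-prime
      ... | no c≢c₀ = ρ-prime (others c∈S c≢c₀)
      ρ′≤ : ∀ {c} → c ∈ S → ρ′ c ≤ c
      ρ′≤ {c} c∈S with c ≟ c₀
      ... | yes refl = Q<c₀
      ... | no c≢c₀  = ρ≤ (others c∈S c≢c₀)
      ρ′≤Q : ∀ {c} → c ∈ S → ρ′ c ≤ suc Q
      ρ′≤Q {c} c∈S with c ≟ c₀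
      ... | yes _    = ≤-refl
      ... | no c≢c₀ = m≤n⇒m≤1+n (ρ≤Q (others c∈S c≢c₀))
      ρ′-injective : ∀ {c c′} → c ∈ S → c′ ∈ S → ρ′ c ≡ ρ′ c′ → c ≡ c′
      ρ′-injective {c} {c′} c∈S c′∈S eq with c ≟ c₀ | c′ ≟ c₀
      ... | yes refl | yes refl = refl
      ... | yes refl | no c′≢c₀ = ⊥-elim (1+n≰n (subst (_≤ Q) (sym eq) (ρ≤Q (others c′∈S c′≢c₀))))
      ... | no c≢c₀  | yes refl = ⊥-elim (1+n≰n (subst (_≤ Q) eq (ρ≤Q (others c∈S c≢c₀))))
      ... | no c≢c₀  | no c′≢c₀ = ρ-injective (others c∈S c≢c₀) (others c′∈S c′≢c₀) eq

  length-without : ∀ {c₀} {S : List ℕ} → Unique S → c₀ ∈ S → length S ≡ suc (length (without c₀ S))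
  length-without {c₀} {x ∷ xs} (x∉xs ∷ _) (here refl) = cong suc (begin
    length xs                   ≡⟨ cong length (List.filter-all (¬? ∘ (_≟ c₀)) (All.map (_∘ sym) x∉xs)) ⟨
    length (without c₀ xs)      ≡⟨ cong length (List.filter-reject (¬? ∘ (_≟ c₀)) {x} {xs} (λ x≢x → x≢x refl)) ⟨
    length (without c₀ (x ∷ xs)) ∎)
    where open ≡-Reasoning
  length-without {c₀} {x ∷ xs} (x∉xs ∷ xs-unique) (there c₀∈xs) =
    trans (cong suc (length-without xs-unique c₀∈xs))
          (cong (suc ∘ length) (sym (List.filter-accept (¬? ∘ (_≟ c₀)) {x} {xs} (All.lookup x∉xs c₀∈xs))))

  -- Induction on Q: when Q + 1 is a prime that is needed, some c₀ ∈ S exceeds Q and takes it.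
  assignPrimes : ∀ Q {S} → Unique S → All Prime S → length S ≤ primesBelow (suc Q) → PrimeAssignment Q S
  assignPrimes zero {[]} _ _ _ = record
    { ρ = λ c → c ; ρ-prime = λ () ; ρ≤ = λ () ; ρ≤Q = λ () ; ρ-injective = λ () }
  assignPrimes (suc Q) {S} unique primes |S|≤ with prime? (suc Q)
  ... | no Q+1-¬prime = weaken (assignPrimes Q unique primes (subst (length S ≤_) (primesBelow-suc-¬prime Q+1-¬prime) |S|≤))
  ... | yes Q+1-prime with length S ≤? primesBelow (suc Q)
  ...   | yes |S|≤′ = weaken (assignPrimes Q unique primes |S|≤′)
  ...   | no  |S|≰  with Any.any? (λ c → suc Q ≤? c) S
  ...     | no  ¬large =
    ⊥-elim (|S|≰ (unique-⊆⇒length≤ unique (All.tabulate λ c∈S → small (All.lookup primes c∈S) c∈S)))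
    where small : ∀ {c} → Prime c → c ∈ S → c ∈ filter prime? (upTo (suc Q))
          small c-prime c∈S =
            ∈-filter⁺ prime? (∈-upTo⁺ (s≤s (≮⇒≥ λ c>Q → ¬large (Any.map (λ where refl → c>Q) c∈S)))) c-prime
  ...     | yes large with find large
  ...       | c₀ , c₀∈S , Q<c₀ = extend Q+1-prime Q<c₀ (assignPrimes Q (Unique.filter⁺ (¬? ∘ (_≟ c₀)) unique)
                                   (All.filter⁺ (¬? ∘ (_≟ c₀)) primes)
                                   (≤-pred (subst₂ _≤_ (length-without unique c₀∈S) (primesBelow-suc-prime Q+1-prime) |S|≤)))


module Monomials where

  open Congruence
  open Multiplicity
  open LinearAlgebra
  open import Data.Nat as ℕ using (ℕ; zero; suc; z≤n; s≤s)
  import Data.Nat.Properties as ℕ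
  open import Data.Integer as ℤ using (ℤ; +_; _+_; _*_; _-_; _^_; 0ℤ; 1ℤ)
  import Data.Integer.Properties as ℤ
  open import Data.Integer.Tactic.RingSolver using (solve-∀)
  open import Algebra.Properties.Semiring.Sum ℤ.+-*-semiring renaming (sum to ∑) using ()
  open import Data.Fin using (Fin; zero; suc; toℕ)
  open import Data.Vec using (Vec; []; _∷_; lookup; sum)
  open import Data.Vec.Properties using (tabulate∘lookup; tabulate-cong)
  open import Function using (_∘_)
  open import Relation.Binary.PropositionalEquality

  pos-^ : ∀ m n → + (m ℕ.^ n) ≡ (+ m) ^ n
  pos-^ m zero    = refl
  pos-^ m (suc n) = trans (ℤ.pos-* m (m ℕ.^ n)) (cong (+ m *_) (pos-^ m n))

  ^-distribʳ-* : ∀ x y n → (x * y) ^ n ≡ x ^ n * y ^ n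
  ^-distribʳ-* x y zero    = refl
  ^-distribʳ-* x y (suc n) = trans (cong ((x * y) *_) (^-distribʳ-* x y n)) (interchange x y (x ^ n) (y ^ n))
    where interchange : ∀ x y a b → x * y * (a * b) ≡ x * a * (y * b)
          interchange = solve-∀

  ^-comm : ∀ x m n → (x ^ m) ^ n ≡ (x ^ n) ^ m
  ^-comm x m n = trans (ℤ.^-*-assoc x m n) (trans (cong (x ^_) (ℕ.*-comm m n)) (sym (ℤ.^-*-assoc x n m)))

  monomial : ∀ {m} → Vec ℕ m → (Fin m → ℕ) → ℕ
  monomial []      u = 1
  monomial (e ∷ α) u = u zero ℕ.^ e ℕ.* monomial α (u ∘ suc)

  monomialℤ : ∀ {m} → Vec ℕ m → (Fin m → ℤ) → ℤ
  monomialℤ []      u = 1ℤ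
  monomialℤ (e ∷ α) u = u zero ^ e * monomialℤ α (u ∘ suc)

  monomial-positive : ∀ {m} (α : Vec ℕ m) {u} → (∀ j → 1 ℕ.≤ u j) → 1 ℕ.≤ monomial α u
  monomial-positive []      u>0 = s≤s z≤n
  monomial-positive (e ∷ α) u>0 = ℕ.*-mono-≤ (ℕ.m^n>0 _ {{ℕ.>-nonZero (u>0 zero)}} e) (monomial-positive α (u>0 ∘ suc))

  monomial≤ : ∀ {m} (α : Vec ℕ m) {u k} → (∀ j → u j ℕ.≤ k) → monomial α u ℕ.≤ k ℕ.^ sum α
  monomial≤ []      u≤k = ℕ.≤-refl
  monomial≤ (e ∷ α) {u} {k} u≤k = begin
    u zero ℕ.^ e ℕ.* monomial α (u ∘ suc)
      ≤⟨ ℕ.*-mono-≤ (ℕ.^-monoˡ-≤ e (u≤k zero)) (monomial≤ α (u≤k ∘ suc)) ⟩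
    k ℕ.^ e ℕ.* k ℕ.^ sum α
      ≡⟨ ℕ.^-distribˡ-+-* k e (sum α) ⟨
    k ℕ.^ (e ℕ.+ sum α) ∎
    where open ℕ.≤-Reasoning

  multiplicity-monomial : ∀ {m} (α : Vec ℕ m) {u} c → (∀ j → 1 ℕ.≤ u j) →
    + multiplicity c (monomial α u) ≡ ∑ (λ j → + lookup α j * + multiplicity c (u j))
  multiplicity-monomial []      c u>0 = refl
  multiplicity-monomial (e ∷ α) {u} c u>0 = begin
    + multiplicity c (u zero ℕ.^ e ℕ.* monomial α (u ∘ suc))
      ≡⟨ cong +_ (multiplicity-* c (ℕ.m^n>0 _ {{ℕ.>-nonZero (u>0 zero)}} e) (monomial-positive α (u>0 ∘ suc))) ⟩
    + (multiplicity c (u zero ℕ.^ e) ℕ.+ multiplicity c (monomial α (u ∘ suc)))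
      ≡⟨ cong (λ n → + (n ℕ.+ _)) (multiplicity-^ c e (u>0 zero)) ⟩
    + (e ℕ.* multiplicity c (u zero) ℕ.+ multiplicity c (monomial α (u ∘ suc)))
      ≡⟨ ℤ.pos-+ (e ℕ.* multiplicity c (u zero)) _ ⟩
    + (e ℕ.* multiplicity c (u zero)) + + multiplicity c (monomial α (u ∘ suc))
      ≡⟨ cong₂ _+_ (ℤ.pos-* e _) (multiplicity-monomial α c (u>0 ∘ suc)) ⟩
    + e * + multiplicity c (u zero) + ∑ (λ j → + lookup α j * + multiplicity c (u (suc j))) ∎
    where open ≡-Reasoning

  monomialℤ-pos : ∀ {m} (α : Vec ℕ m) u → monomialℤ α (+_ ∘ u) ≡ + monomial α u
  monomialℤ-pos []      u = refl
  monomialℤ-pos (e ∷ α) u =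
    trans (cong₂ _*_ (sym (pos-^ (u zero) e)) (monomialℤ-pos α (u ∘ suc))) (sym (ℤ.pos-* (u zero ℕ.^ e) _))

  monomialℤ-* : ∀ {m} (α : Vec ℕ m) u w → monomialℤ α (λ j → u j * w j) ≡ monomialℤ α u * monomialℤ α w
  monomialℤ-* []      u w = refl
  monomialℤ-* (e ∷ α) u w =
    trans (cong₂ _*_ (^-distribʳ-* (u zero) (w zero) e) (monomialℤ-* α (u ∘ suc) (w ∘ suc)))
          (interchange (u zero ^ e) (w zero ^ e) _ _)
    where interchange : ∀ x y a b → x * y * (a * b) ≡ x * a * (y * b)
          interchange = solve-∀

  monomialℤ-const : ∀ {m} (α : Vec ℕ m) x → monomialℤ α (λ _ → x) ≡ x ^ sum α
  monomialℤ-const []      x = refl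
  monomialℤ-const (e ∷ α) x = trans (cong (x ^ e *_) (monomialℤ-const α x)) (sym (ℤ.^-distribˡ-+-* x e (sum α)))

  monomialℤ-^ : ∀ {m} (α : Vec ℕ m) u n → monomialℤ α u ^ n ≡ monomialℤ α (λ j → u j ^ n)
  monomialℤ-^ []      u n = ℤ.^-zeroˡ n
  monomialℤ-^ (e ∷ α) u n =
    trans (^-distribʳ-* _ _ n) (cong₂ _*_ (^-comm (u zero) e n) (monomialℤ-^ α (u ∘ suc) n))

  monomialℤ-cong : ∀ {p m} (α : Vec ℕ m) {u w} → (∀ j → u j ≈ w j mod p) → monomialℤ α u ≈ monomialℤ α w mod p
  monomialℤ-cong []      u≈w = ≈-refl
  monomialℤ-cong (e ∷ α) u≈w = *-cong-mod (^-cong-mod e (u≈w zero)) (monomialℤ-cong α (u≈w ∘ suc))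

  multiplicities : ∀ {n B} → (Fin n → ℕ) → Matrix n B
  multiplicities u i c = + multiplicity (toℕ c) (u i)

  -- By unique factorisation the exponent difference α - β is a vanishing combination of the rows.
  monomial-injective : ∀ {m B} {u : Fin m → ℕ} → (∀ j → 1 ℕ.≤ u j) → LinearlyIndependent (multiplicities {B = B} u) →
                       ∀ α β → monomial α u ≡ monomial β u → α ≡ β
  monomial-injective {u = u} u>0 independent α β same =
    trans (sym (tabulate∘lookup α)) (trans (tabulate-cong exponents≡) (tabulate∘lookup β))
    where
      exponents≡ : ∀ j → lookup α j ≡ lookup β j
      exponents≡ j = ℤ.+-injective (ℤ.i-j≡0⇒i≡j _ _ (independent (λ j → + lookup α j - + lookup β j) vanishes j))
        where
          vanishes : ∀ c → combination (λ j → + lookup α j - + lookup β j) (multiplicities u) c ≡ 0ℤ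
          vanishes c = begin
            combination (λ j → + lookup α j - + lookup β j) (multiplicities u) c
              ≡⟨ combination-− (λ j → + lookup α j) (λ j → + lookup β j) (multiplicities u) c ⟩
            combination (λ j → + lookup α j) (multiplicities u) c - combination (λ j → + lookup β j) (multiplicities u) c
              ≡⟨ cong₂ _-_ (multiplicity-monomial α (toℕ c) u>0) (multiplicity-monomial β (toℕ c) u>0) ⟨
            + multiplicity (toℕ c) (monomial α u) - + multiplicity (toℕ c) (monomial β u)
              ≡⟨ cong (λ N → + multiplicity (toℕ c) (monomial α u) - + multiplicity (toℕ c) N) same ⟨
            + multiplicity (toℕ c) (monomial α u) - + multiplicity (toℕ c) (monomial α u)
              ≡⟨ ℤ.+-inverseʳ (+ multiplicity (toℕ c) (monomial α u)) ⟩
            0ℤ ∎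
            where open ≡-Reasoning


module SmoothCompression where

  open Multiplicity
  open LinearAlgebra
  open Lists using (injective⇒length≤)
  open PrimeAssignments
  open Monomials using (multiplicities)
  open import Data.Nat
  open import Data.Nat.Properties
  open import Data.Nat.Primality using (Prime; productOfPrimes≥1; prime⇒nonZero)
  open import Data.Nat.Primality.Factorisation using (PrimeFactorisation; factorisationHasAllPrimeFactors)
  open import Data.Nat.ListAction using (product)
  open import Data.Integer as ℤ using (+_)
  import Data.Integer.Properties as ℤ
  open import Data.Fin as Fin using (Fin; toℕ; fromℕ<)
  import Data.Fin.Properties as Fin
  open import Data.List as List using (List; []; _∷_; length; map; filter; upTo)
  import Data.List.Properties as List
  open import Data.List.Membership.Propositional using (_∈_)
  open import Data.List.Membership.Propositional.Properties using (∈-filter⁺; ∈-filter⁻; ∈-upTo⁺; ∈-map⁺; ∈-map⁻; ∈-lookup)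
  open import Data.List.Membership.DecPropositional _≟_ using (_∈?_)
  open import Data.List.Relation.Unary.All as All using (All; []; _∷_)
  import Data.List.Relation.Unary.All.Properties as All
  open import Data.List.Relation.Unary.Any using (index)
  open import Data.List.Relation.Unary.Any.Properties using (lookup-index)
  open import Data.List.Relation.Unary.Unique.Propositional using (Unique)
  import Data.List.Relation.Unary.Unique.Propositional.Properties as Unique
  open import Data.Product using (_×_; _,_; proj₁; proj₂)
  open import Relation.Nullary using (yes; no)
  open import Function using (_∘_)
  open import Relation.Binary.PropositionalEquality

  module Compression {q} {S : List ℕ} (assignment : PrimeAssignment q S) where

    open PrimeAssignment assignment

    factorsIn : ℕ → List ℕ
    factorsIn n = filter (_∈? S) (primeFactors n)

    factorsIn⊆ : ∀ n → All (_∈ S) (factorsIn n)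
    factorsIn⊆ n = All.tabulate (proj₂ ∘ ∈-filter⁻ (_∈? S) {xs = primeFactors n})

    compress : ℕ → ℕ
    compress n = product (map ρ (factorsIn n))

    compress-factors-prime : ∀ n → All Prime (map ρ (factorsIn n))
    compress-factors-prime n = All.map⁺ (All.map ρ-prime (factorsIn⊆ n))

    compress-positive : ∀ n → 1 ≤ compress n
    compress-positive n = productOfPrimes≥1 (compress-factors-prime n)

    compress-smooth : ∀ n → Smooth q (compress n)
    compress-smooth n d d-prime d∣ with ∈-map⁻ ρ (factorisationHasAllPrimeFactors d-prime d∣ (compress-factors-prime n))
    ... | c , c∈ , d≡ρc = subst (_≤ q) (sym d≡ρc) (ρ≤Q (All.lookup (factorsIn⊆ n) c∈))

    compress≤ : ∀ {n} → 1 ≤ n → compress n ≤ n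
    compress≤ {n} 1≤n = begin
      product (map ρ (factorsIn n))   ≤⟨ product-map≤ (factorsIn⊆ n) ⟩
      product (factorsIn n)           ≤⟨ product-filter≤ (primeFactors n) (primeFactors-prime n) ⟩
      product (primeFactors n)        ≡⟨ product-primeFactors 1≤n ⟩
      n                               ∎
      where
        open ≤-Reasoning
        product-map≤ : ∀ {xs} → All (_∈ S) xs → product (map ρ xs) ≤ product xs
        product-map≤ []            = ≤-refl
        product-map≤ (x∈S ∷ xs⊆S) = *-mono-≤ (ρ≤ x∈S) (product-map≤ xs⊆S)
        product-filter≤ : ∀ xs → All Prime xs → product (filter (_∈? S) xs) ≤ product xs
        product-filter≤ []       []                = ≤-refl
        product-filter≤ (x ∷ xs) (x-prime ∷ primes) with x ∈? S
        ... | yes _ = *-monoʳ-≤ x (product-filter≤ xs primes)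
        ... | no  _ = ≤-trans (product-filter≤ xs primes) (m≤n*m (product xs) x {{prime⇒nonZero x-prime}})

    multiplicity-compress : ∀ {c} n → c ∈ S → multiplicity (ρ c) (compress n) ≡ multiplicity c n
    multiplicity-compress {c} n c∈S = begin
      multiplicity (ρ c) (compress n)              ≡⟨ multiplicity-factorisation (ρ c) factorisation (compress-positive n) ⟩
      count (ρ c) (map ρ (factorsIn n))            ≡⟨ count-map ρ ρ-injective c∈S (factorsIn⊆ n) ⟩
      count c (factorsIn n)                        ≡⟨ count-filter (_∈? S) c∈S (primeFactors n) ⟩
      multiplicity c n                             ∎
      where
        open ≡-Reasoning
        factorisation : PrimeFactorisation (compress n)
        factorisation = record { factors = map ρ (factorsIn n) ; isFactorisation = refl ; factorsPrime = compress-factors-prime n }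

  multiplicities-agree : ∀ {k m n} → m ≤ k → n ≤ k →
    (∀ (c : Fin (suc k)) → multiplicity (toℕ c) m ≡ multiplicity (toℕ c) n) → ∀ c → multiplicity c m ≡ multiplicity c n
  multiplicities-agree {k} {m} {n} m≤k n≤k agree c with c <? suc k
  ... | yes c≤k = subst (λ c → multiplicity c m ≡ multiplicity c n) (Fin.toℕ-fromℕ< c≤k) (agree (fromℕ< c≤k))
  ... | no  c≰k = trans (multiplicity-beyond (≤-<-trans m≤k k<c)) (sym (multiplicity-beyond (≤-<-trans n≤k k<c)))
    where k<c : k < c
          k<c = ≤-pred (≰⇒> c≰k)

  ∈-map-suc-upTo : ∀ {n k} → 1 ≤ n → n ≤ k → n ∈ map suc (upTo k)
  ∈-map-suc-upTo {suc n} (s≤s _) n<k = ∈-map⁺ suc (∈-upTo⁺ n<k)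

  fewColumns⇒length≤Ψ : ∀ {k q m} {hs : List ℕ} → Unique hs → All (λ h → 1 ≤ h × h ≤ k) hs →
    m ≤ primesBelow (suc q) → FewDeterminingColumns m (multiplicities {B = suc k} (List.lookup hs)) →
    length hs ≤ Ψ k q
  fewColumns⇒length≤Ψ {k} {q} {m} {hs} hs-unique range m≤ (S , |S|≤m , S-unique , nonzero , determining) =
    injective⇒length≤ compress hs-unique compress-injective (All.tabulate compress∈smooth)
    where
      V : Matrix (length hs) (suc k)
      V = multiplicities (List.lookup hs)

      column-prime : ∀ {c} → NonzeroColumn V c → Prime (toℕ c)
      column-prime (i , Vic≢0) =
        proj₁ (multiplicity>0⇒prime∣ (proj₁ (All.lookup range (∈-lookup i))) (n≢0⇒n>0 λ m≡0 → Vic≢0 (cong +_ m≡0)))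

      assignment : PrimeAssignment q (map toℕ S)
      assignment = assignPrimes q (Unique.map⁺ Fin.toℕ-injective S-unique) (All.map⁺ (All.map column-prime nonzero))
                     (≤-trans (≤-reflexive (List.length-map toℕ S)) (≤-trans |S|≤m m≤))
      open Compression assignment
      open PrimeAssignment assignment using (ρ)

      row : ∀ {h} (h∈ : h ∈ hs) c → V (index h∈) c ≡ + multiplicity (toℕ c) h
      row h∈ c = cong (+_ ∘ multiplicity (toℕ c)) (sym (lookup-index h∈))

      compress-injective : ∀ {h h′} → h ∈ hs → h′ ∈ hs → compress h ≡ compress h′ → h ≡ h′
      compress-injective {h} {h′} h∈ h′∈ same =
        multiplicity-injective (proj₁ (All.lookup range h∈)) (proj₁ (All.lookup range h′∈))
          (multiplicities-agree (proj₂ (All.lookup range h∈)) (proj₂ (All.lookup range h′∈)) λ c →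
            ℤ.+-injective (trans (sym (row h∈ c))
              (trans (determining-rows determining (index h∈) (index h′∈) agree-on-S c) (row h′∈ c))))
        where
          agree-on-S : ∀ c → c ∈ S → V (index h∈) c ≡ V (index h′∈) c
          agree-on-S c c∈S = begin
            V (index h∈) c                               ≡⟨ row h∈ c ⟩
            + multiplicity (toℕ c) h                     ≡⟨ cong +_ (multiplicity-compress h c∈SN) ⟨
            + multiplicity (ρ (toℕ c)) (compress h)      ≡⟨ cong (+_ ∘ multiplicity (ρ (toℕ c))) same ⟩
            + multiplicity (ρ (toℕ c)) (compress h′)     ≡⟨ cong +_ (multiplicity-compress h′ c∈SN) ⟩
            + multiplicity (toℕ c) h′                    ≡⟨ row h′∈ c ⟨
            V (index h′∈) c                              ∎
            where open ≡-Reasoning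
                  c∈SN : toℕ c ∈ map toℕ S
                  c∈SN = ∈-map⁺ toℕ c∈S

      compress∈smooth : ∀ {h} → h ∈ hs → compress h ∈ filter (smooth? q) (map suc (upTo k))
      compress∈smooth {h} h∈ = ∈-filter⁺ (smooth? q) (∈-map-suc-upTo (compress-positive h) compress≤k) (compress-smooth h)
        where compress≤k : compress h ≤ k
              compress≤k = ≤-trans (compress≤ (proj₁ (All.lookup range h∈))) (proj₂ (All.lookup range h∈))


module Residues where

  open Congruence
  open import Data.Nat as ℕ using (ℕ; _≤_; _<_; _∸_; _⊔_)
  import Data.Nat.Properties as ℕ
  open import Data.Nat.DivMod using (m<n⇒m%n≡m)
  import Data.Nat.Divisibility as ℕ
  open import Data.Nat.Primality using (Prime; prime⇒irreducible)
  open import Data.Integer as ℤ using (+_; _+_; _*_; _-_; _⊖_)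
  import Data.Integer.Properties as ℤ
  open import Data.Integer.Divisibility.Signed using (_∣_; divides; ∣⇒∣ᵤ)
  open import Data.Integer.Tactic.RingSolver using (solve-∀)
  open import Data.Sum using (inj₁; inj₂)
  open import Data.Empty using (⊥-elim)
  open import Relation.Binary.PropositionalEquality

  ∣∧<⇒≡0 : ∀ {p n} → p ℕ.∣ n → n < p → n ≡ 0
  ∣∧<⇒≡0 {p@(ℕ.suc _)} {n} p∣n n<p = trans (sym (m<n⇒m%n≡m n<p)) (ℕ.n∣m⇒m%n≡0 n p p∣n)

  height≡0⇒≡0 : ∀ {p x} → x < p → height p x ≡ 0 → x ≡ 0
  height≡0⇒≡0 {p} {x} x<p height≡0 with ℕ.⊓-sel x (p ∸ x)
  ... | inj₁ min≡x    = trans (sym min≡x) height≡0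
  ... | inj₂ min≡p∸x = ⊥-elim (ℕ.<⇒≱ x<p (ℕ.m∸n≡0⇒m≤n (trans (sym min≡p∸x) height≡0)))

  height-square : ∀ {p x} → x ≤ p → + x * + x ≈ + height p x * + height p x mod p
  height-square {p} {x} x≤p with ℕ.⊓-sel x (p ∸ x)
  ... | inj₁ min≡x    = ≈-reflexive (cong (λ h → + h * + h) (sym min≡x))
  ... | inj₂ min≡p∸x = subst (λ h → + x * + x ≈ + h * + h mod p) (sym min≡p∸x) (mk≈ (divides (+ x + + x - + p) (begin
    + x * + x - + (p ∸ x) * + (p ∸ x)      ≡⟨ cong (λ y → + x * + x - y * y) p∸x≡ ⟩
    + x * + x - (+ p - + x) * (+ p - + x)  ≡⟨ expand (+ x) (+ p) ⟩
    (+ x + + x - + p) * + p                ∎)))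
    where
      open ≡-Reasoning
      p∸x≡ : + (p ∸ x) ≡ + p - + x
      p∸x≡ = trans (sym (ℤ.⊖-≥ x≤p)) (sym (ℤ.m-n≡m⊖n p x))
      expand : ∀ x p → x * x - (p - x) * (p - x) ≡ (x + x - p) * p
      expand = solve-∀

  square-congruent⇒≡ : ∀ {p m n} → Prime p → m ℕ.+ n < p → + m * + m ≈ + n * + n mod p → m ≡ n
  square-congruent⇒≡ {p} {m} {n} p-prime m+n<p (mk≈ p∣m²-n²)
    with prime∣*⇒∣⊎∣ p-prime (+ m - + n) (+ m + + n) (subst (+ p ∣_) (difference-of-squares (+ m) (+ n)) p∣m²-n²)
    where difference-of-squares : ∀ x y → x * x - y * y ≡ (x - y) * (x + y)
          difference-of-squares = solve-∀
  ... | inj₁ p∣m-n =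
    ℤ.+-injective (ℤ.i-j≡0⇒i≡j (+ m) (+ n) (ℤ.∣i∣≡0⇒i≡0 (∣∧<⇒≡0 (∣⇒∣ᵤ p∣m-n) ∣m-n∣<p)))
    where
      ∣m-n∣<p : ℤ.∣ + m - + n ∣ < p
      ∣m-n∣<p = begin-strict
        ℤ.∣ + m - + n ∣  ≡⟨ cong ℤ.∣_∣ (ℤ.m-n≡m⊖n m n) ⟩
        ℤ.∣ m ⊖ n ∣      ≤⟨ ℤ.∣m⊝n∣≤m⊔n m n ⟩
        m ⊔ n            ≤⟨ ℕ.m⊔n≤m+n m n ⟩
        m ℕ.+ n          <⟨ m+n<p ⟩
        p                ∎
        where open ℕ.≤-Reasoning
  ... | inj₂ p∣m+n with ∣∧<⇒≡0 (subst (p ℕ.∣_) (cong ℤ.∣_∣ (sym (ℤ.pos-+ m n))) (∣⇒∣ᵤ p∣m+n)) m+n<p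
  ... | m+n≡0 = trans (ℕ.m+n≡0⇒m≡0 m m+n≡0) (sym (ℕ.m+n≡0⇒n≡0 m m+n≡0))

  2*m≤p⇒2*m<p : ∀ {p m} → Prime p → 2 < p → 2 ℕ.* m ≤ p → 2 ℕ.* m < p
  2*m≤p⇒2*m<p {p} {m} p-prime 2<p 2m≤p with ℕ.m≤n⇒m<n∨m≡n 2m≤p
  ... | inj₁ 2m<p = 2m<p
  ... | inj₂ 2m≡p with prime⇒irreducible p-prime (ℕ.divides m (trans (sym 2m≡p) (ℕ.*-comm 2 m)))
  ...   | inj₁ ()
  ...   | inj₂ 2≡p = ⊥-elim (ℕ.<⇒≢ 2<p 2≡p)


module Heights (p t k a : ℕ) .{{_ : NonZero p}} (p-prime : Prime p) (1≤t : 1 ≤ t) (1≤a : 1 ≤ a) (a<p : a < p) where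

  open Congruence
  open MonicPolynomials
  open LinearAlgebra
  open Lists using (allPairs-map-All)
  open Compositions
  open Monomials
  open Residues
  open Multiplicity using (prime⇒1<p)
  open import Data.Nat as ℕ using (ℕ; zero; suc; z≤n; s≤s; _≤_; _<_; _∸_; NonZero)
  import Data.Nat.Properties as ℕ
  open import Data.Nat.DivMod using (m<n⇒m%n≡m)
  open import Data.Nat.Combinatorics using (_C_)
  open import Data.Nat.Primality using (Prime)
  open import Data.Integer as ℤ using (ℤ; +_; _+_; _*_; _-_; -_; _^_; 0ℤ; 1ℤ)
  import Data.Integer.Properties as ℤ
  open import Data.Integer.Divisibility.Signed using (_∣_; ∣m⇒∣-m; ∣m∣n⇒∣m-n; ∣⇒∣ᵤ)
  open import Data.Integer.Tactic.RingSolver using (solve-∀)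
  open import Data.Fin using (Fin; toℕ)
  import Data.Fin.Properties as Fin
  open import Data.Vec as Vec using (Vec; replicate)
  open import Data.Vec using () renaming (_∷_ to _∷ᵥ_)
  open import Data.List as List using (List; length; map; filter; upTo)
  import Data.List.Properties as List
  open import Data.List.Membership.Propositional using (_∈_)
  open import Data.List.Membership.Propositional.Properties using (∈-filter⁻; ∈-upTo⁻; ∈-lookup)
  open import Data.List.Relation.Unary.All as All using (All)
  import Data.List.Relation.Unary.All.Properties as All
  open import Data.List.Relation.Unary.AllPairs using (AllPairs)
  import Data.List.Relation.Unary.AllPairs.Properties as AllPairs
  open import Data.List.Relation.Unary.Unique.Propositional using (Unique)
  import Data.List.Relation.Unary.Unique.Propositional.Properties as Unique
  open import Data.Product using (_×_; _,_; proj₁; proj₂)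
  open import Data.Sum using (inj₁; inj₂)
  open import Data.Empty using (⊥-elim)
  open import Function using (_∘_)
  open import Relation.Nullary using (¬_)
  open import Relation.Binary.PropositionalEquality

  heights : List ℕ
  heights = filter (isHeightInU? p k t a) (upTo (suc k))

  record Witness (h : ℕ) : Set where
    field
      x g      : ℕ
      x<p      : x < p
      x≈ag     : + x ≈ + a * + g mod p
      g^t≈1    : (+ g) ^ t ≈ 1ℤ mod p
      height≡h : height p x ≡ h

  witness : ∀ {h} → h ∈ heights → Witness h
  witness h∈ with proj₂ (∈-filter⁻ (isHeightInU? p k t a) h∈)
  ... | x , ((g , g^t%p≡1 , x%p≡ag%p) , _) , height≡h = record
    { x        = toℕ x
    ; g        = toℕ g
    ; x<p      = Fin.toℕ<n x
    ; x≈ag     = ≈-trans (%-≈ x%p≡ag%p) (≈-reflexive (ℤ.pos-* a (toℕ g)))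
    ; g^t≈1    = ≈-trans (≈-reflexive (sym (pos-^ (toℕ g) t))) (%-≈ (trans g^t%p≡1 (sym (m<n⇒m%n≡m 1<p))))
    ; height≡h = height≡h
    }
    where 1<p : 1 < p
          1<p = prime⇒1<p p-prime

  heights≤k : ∀ {h} → h ∈ heights → h ≤ k
  heights≤k h∈ = ℕ.≤-pred (∈-upTo⁻ (proj₁ (∈-filter⁻ (isHeightInU? p k t a) h∈)))

  -- p ∤ a, and p ∣ g is impossible as g^t ≡ 1.
  aG-nonzero : ∀ {g} → (+ g) ^ t ≈ 1ℤ mod p → ¬ 0ℤ ≈ + a * + g mod p
  aG-nonzero {g} (mk≈ p∣g^t-1) (mk≈ p∣0-ag)
    with prime∣*⇒∣⊎∣ p-prime (+ a) (+ g)
           (subst (+ p ∣_) (trans (cong -_ (ℤ.+-identityˡ _)) (ℤ.neg-involutive _)) (∣m⇒∣-m p∣0-ag))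
  ... | inj₁ p∣a = ℕ.<⇒≢ 1≤a (sym (∣∧<⇒≡0 (∣⇒∣ᵤ p∣a) a<p))
  ... | inj₂ p∣g = prime∤1 p-prime (subst (+ p ∣_) (cancel ((+ g) ^ t)) (∣m∣n⇒∣m-n (∣⇒∣^ p∣g 1≤t) p∣g^t-1))
    where cancel : ∀ x → x - (x - 1ℤ) ≡ 1ℤ
          cancel = solve-∀

  heights-positive : ∀ {h} → h ∈ heights → 1 ≤ h
  heights-positive {suc h} h∈ = s≤s z≤n
  heights-positive {zero}  h∈ =
    ⊥-elim (aG-nonzero g^t≈1 (subst (λ x → + x ≈ + a * + g mod p) (height≡0⇒≡0 x<p height≡h) x≈ag))
    where open Witness (witness h∈)

  heights-range : All (λ h → 1 ≤ h × h ≤ k) heights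
  heights-range = All.tabulate λ h∈ → heights-positive h∈ , heights≤k h∈

  heights-unique : Unique heights
  heights-unique = Unique.filter⁺ (isHeightInU? p k t a) (Unique.upTo⁺ (suc k))

  heightMatrix : Matrix (length heights) (suc k)
  heightMatrix = multiplicities (List.lookup heights)

  module IndependentHeights {r j} (2<p : 2 < p) (2k^r≤p : 2 ℕ.* k ℕ.^ r ≤ p)
    (σ : Fin (suc j) → Fin (length heights)) (independent : LinearlyIndependent (heightMatrix ∘ σ)) where

    u : Fin (suc j) → ℕ
    u = List.lookup heights ∘ σ

    w : ∀ i → Witness (u i)
    w i = witness (∈-lookup (σ i))

    X G : Fin (suc j) → ℤ
    X i = + Witness.x (w i)
    G i = + Witness.g (w i)

    y : Vec ℕ (suc j) → ℤ
    y α = monomialℤ α X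

    N : Vec ℕ (suc j) → ℕ
    N α = monomial α u

    A : ℤ
    A = ((+ a) ^ r) ^ t

    Y^t-A : Vec ℤ (suc (t ∸ 1))
    Y^t-A = - A ∷ᵥ replicate (t ∸ 1) 0ℤ

    y^t≈A : ∀ α → Vec.sum α ≡ r → y α ^ t ≈ A mod p
    y^t≈A α |α|≡r = begin
      y α ^ t
        ≈⟨ ^-cong-mod t (monomialℤ-cong α (Witness.x≈ag ∘ w)) ⟩
      monomialℤ α (λ i → + a * G i) ^ t
        ≡⟨ cong (_^ t) (monomialℤ-* α (λ _ → + a) G) ⟩
      (monomialℤ α (λ _ → + a) * monomialℤ α G) ^ t
        ≡⟨ cong (λ z → (z * monomialℤ α G) ^ t) (trans (monomialℤ-const α (+ a)) (cong ((+ a) ^_) |α|≡r)) ⟩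
      ((+ a) ^ r * monomialℤ α G) ^ t
        ≡⟨ ^-distribʳ-* ((+ a) ^ r) (monomialℤ α G) t ⟩
      A * monomialℤ α G ^ t
        ≡⟨ cong (A *_) (monomialℤ-^ α G t) ⟩
      A * monomialℤ α (λ i → G i ^ t)
        ≈⟨ *-cong-mod (≈-refl {x = A}) (monomialℤ-cong α (Witness.g^t≈1 ∘ w)) ⟩
      A * monomialℤ α (λ _ → 1ℤ)
        ≡⟨ cong (A *_) (trans (monomialℤ-const α 1ℤ) (ℤ.^-zeroˡ (Vec.sum α))) ⟩
      A * 1ℤ
        ≡⟨ ℤ.*-identityʳ A ⟩
      A ∎
      where open import Relation.Binary.Reasoning.Setoid (≈-setoid {p})

    y²≈N² : ∀ α → y α * y α ≈ + N α * + N α mod p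
    y²≈N² α = begin
      y α * y α                                           ≡⟨ monomialℤ-* α X X ⟨
      monomialℤ α (λ i → X i * X i)                       ≈⟨ monomialℤ-cong α (λ i → height-square′ i) ⟩
      monomialℤ α (λ i → + u i * + u i)                   ≡⟨ monomialℤ-* α (+_ ∘ u) (+_ ∘ u) ⟩
      monomialℤ α (+_ ∘ u) * monomialℤ α (+_ ∘ u)         ≡⟨ cong₂ _*_ (monomialℤ-pos α u) (monomialℤ-pos α u) ⟩
      + N α * + N α                                       ∎
      where
        open import Relation.Binary.Reasoning.Setoid (≈-setoid {p})
        height-square′ : ∀ i → X i * X i ≈ + u i * + u i mod p
        height-square′ i = subst (λ h → X i * X i ≈ + h * + h mod p) (Witness.height≡h (w i))
                                 (height-square (ℕ.<⇒≤ (Witness.x<p (w i))))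

    N≤k^r : ∀ α → Vec.sum α ≡ r → N α ≤ k ℕ.^ r
    N≤k^r α |α|≡r = subst (λ e → N α ≤ k ℕ.^ e) |α|≡r (monomial≤ α (heights≤k ∘ ∈-lookup ∘ σ))

    y-distinct : ∀ {α β} → Vec.sum α ≡ r → Vec.sum β ≡ r → α ≢ β → ¬ y α ≈ y β mod p
    y-distinct {α} {β} |α|≡r |β|≡r α≢β yα≈yβ =
      α≢β (monomial-injective (heights-positive ∘ ∈-lookup ∘ σ) independent α β (square-congruent⇒≡ p-prime Nα+Nβ<p Nα²≈Nβ²))
      where
        Nα²≈Nβ² : + N α * + N α ≈ + N β * + N β mod p
        Nα²≈Nβ² = ≈-trans (≈-sym (y²≈N² α)) (≈-trans (*-cong-mod yα≈yβ yα≈yβ) (y²≈N² β))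
        Nα+Nβ<p : N α ℕ.+ N β < p
        Nα+Nβ<p = begin-strict
          N α ℕ.+ N β                 ≤⟨ ℕ.+-mono-≤ (N≤k^r α |α|≡r) (N≤k^r β |β|≡r) ⟩
          k ℕ.^ r ℕ.+ k ℕ.^ r         ≡⟨ cong (k ℕ.^ r ℕ.+_) (ℕ.+-identityʳ (k ℕ.^ r)) ⟨
          2 ℕ.* k ℕ.^ r               <⟨ 2*m≤p⇒2*m<p {m = k ℕ.^ r} p-prime 2<p 2k^r≤p ⟩
          p                           ∎
          where open ℕ.≤-Reasoning

    ys-distinct : AllPairs (λ y z → ¬ y ≈ z mod p) (map y (compositions j r))
    ys-distinct = AllPairs.map⁺ (allPairs-map-All y-distinct (compositions-sum j r) (compositions-unique j r))

    ys-roots : All (λ z → + p ∣ evalMonic Y^t-A z) (map y (compositions j r))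
    ys-roots = All.map⁺ (All.map (λ {α} → root {α}) (compositions-sum j r))
      where
        root : ∀ {α} → Vec.sum α ≡ r → + p ∣ evalMonic Y^t-A (y α)
        root {α} |α|≡r = subst (+ p ∣_) y^t-A≡ (p∣x-y (y^t≈A α |α|≡r))
          where
            y^t-A≡ : y α ^ t - A ≡ evalMonic Y^t-A (y α)
            y^t-A≡ = begin
              y α ^ t - A                 ≡⟨ ℤ.+-comm (y α ^ t) (- A) ⟩
              - A + y α ^ t               ≡⟨ cong (λ e → - A + y α ^ e) (ℕ.m+[n∸m]≡n 1≤t) ⟨
              - A + y α ^ suc (t ∸ 1)     ≡⟨ evalMonic-X^n+c (- A) (t ∸ 1) (y α) ⟨
              evalMonic Y^t-A (y α)       ∎
              where open ≡-Reasoning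

    binomial≤t : (r ℕ.+ j) C j ≤ t
    binomial≤t = begin
      (r ℕ.+ j) C j                      ≡⟨ length-compositions j r ⟨
      length (compositions j r)          ≡⟨ List.length-map y (compositions j r) ⟨
      length (map y (compositions j r))  ≤⟨ roots≤degree p-prime Y^t-A ys-distinct ys-roots ⟩
      suc (t ∸ 1)                        ≡⟨ ℕ.m+[n∸m]≡n 1≤t ⟩
      t                                  ∎
      where open ℕ.≤-Reasoning

  independentHeights⇒binomial≤t : ∀ r {j} → 2 < p → 2 ℕ.* k ℕ.^ r ≤ p →
                                  IndependentRows (suc j) heightMatrix → (r ℕ.+ j) C j ≤ t
  independentHeights⇒binomial≤t r 2<p 2k^r≤p (σ , independent) =
    IndependentHeights.binomial≤t {r} 2<p 2k^r≤p σ independent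


open LinearAlgebra using (independentRows⊎determiningColumns)
open PrimeAssignments using (primesBelow-suc-prime)
open SmoothCompression using (fewColumns⇒length≤Ψ)
open import Data.Nat using (_*_; _∸_)
open import Data.Nat.Properties using (1+n≰n; ≤-reflexive)
open import Data.Nat.Divisibility using (_∣_)
open import Data.Product using (_,_)
open import Data.Sum using ([_,_]′)
open import Data.Empty using (⊥-elim)
open import Relation.Binary.PropositionalEquality using (_≡_; sym; trans)

theorem1p1 : (p t k a r₀ s q : ℕ) → .{{_ : NonZero p}} →
    Prime p → 2 < p →
    1 ≤ t → t ∣ p ∸ 1 →
    1 < k → 2 * k < p →
    1 ≤ a → a < p →
    IsR0 p k r₀ → IsS0 r₀ t s → IsNthPrime (suc s) q →
    heightCount p k t a ≤ Ψ k q
theorem1p1 p t k a r₀ s q p-prime 2<p 1≤t _ _ _ 1≤a a<p (2k^r₀≤p , _) (_ , s-maximal) (q-prime , s+1-primes<q) =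
  [ (λ independent → ⊥-elim (1+n≰n (s-maximal (suc s) (independentHeights⇒binomial≤t r₀ 2<p 2k^r₀≤p independent))))
  , fewColumns⇒length≤Ψ heights-unique heights-range (≤-reflexive (sym s+1-primes≤q))
  ]′ (independentRows⊎determiningColumns (suc s) heightMatrix)
  where
    open Heights p t k a p-prime 1≤t 1≤a a<p
    s+1-primes≤q : primesBelow (suc q) ≡ suc s
    s+1-primes≤q = trans (primesBelow-suc-prime q-prime) s+1-primes<q
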